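{- Let $\mathcal E$ be a path object category with its associated cloven weak factorisation system. For every cloven $\mathcal R$-map $(x,p)\colon X\to\Gamma$, the factorisation $X\xrightarrow{r_x}M_\Gamma(x)\xrightarrow{(s_x,t_x)}X\times_\Gamma X$ of the diagonal admits a cloven $\mathcal L$-map structure on $r_x$ and a cloven $\mathcal R$-map structure on $(s_x,t_x)$; hence this assignment yields a choice of diagonal factorisations.
   Context: Path object category: finitely complete $\mathcal E$ with (Axiom 1) a pullback-preserving endofunctor $M$ and natural $s,t\colon MX\to X$, $r\colon X\to MX$, $m\colon MX\,{}_{s_X}\!\times_{t_X}MX\to MX$, $\tau$ making $(X,MX,s_X,t_X,r_X,m_X)$ an internal category ($s_Xm_X=s_X\pi_2$, $t_Xm_X=t_X\pi_1$) with $\tau_X$ an involution giving an identity-on-objects isomorphism with its opposite; (Axiom 2) a strength $\alpha_{X,Y}\colon MX\times Y\to M(X\times Y)$ for which $s,t,r,m,\tau$ are strong; (Axiom 3) a strong natural $\eta\colon M\Rightarrow MM$ with $s_{MX}\eta_X=1$, $t_{MX}\eta_X=r_Xt_X$, $Ms_X\eta_X=1$, $Mt_X\eta_X=\alpha_{1,X}(M!,t_X)$, $\eta_Xr_X=r_{MX}r_X$. Associated cloven w.f.s.: for $f\colon X\to Y$, $Pf=X\times_{f,t_Y}MY$ with projections $e_f,d_f$; $\rho_f=s_Yd_f$; $\lambda_f=(1_X,r_Yf)$; $P(h,k)=(he_f,Mk\,d_f)$. A cloven $\mathcal L$-map structure on $f$ is $s\colon Y\to Pf$ with $sf=\lambda_f$,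 $\rho_fs=1$; a cloven $\mathcal R$-map structure is $p\colon Pf\to X$ with $p\lambda_f=1$, $fp=\rho_f$. $M_\Gamma(x)$ is the pullback of $Mx$ along $\alpha_{1,\Gamma}\colon M1\times\Gamma\to M\Gamma$, with projection $j_x\colon M_\Gamma(x)\to MX$; $s_x=s_Xj_x$, $t_x=t_Xj_x$; $r_x\colon X\to M_\Gamma(x)$ is the unique map with $j_xr_x=r_X$ (it exists since $r_\Gamma=\alpha_{1,\Gamma}(r_1\times\Gamma)$). A choice of diagonal factorisations assigns to each cloven $\mathcal R$-map $X\to\Gamma$ a factorisation of $X\to X\times_\Gamma X$ into a cloven $\mathcal L$-map followed by a cloven $\mathcal R$-map. -}

module Defs where

open import Level using (Level; _⊔_) renaming (suc to lsuc)
open import Data.Product using (Σ; _,_; proj₁; proj₂) renaming (_×_ to _∧_)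
open import Relation.Binary.PropositionalEquality
  using (_≡_; refl; sym; trans; cong; cong₂; module ≡-Reasoning)

record Category (o ℓ : Level) : Set (lsuc (o ⊔ ℓ)) where
  infixr 9 _∘_
  field
    Obj  : Set o
    Hom  : Obj → Obj → Set ℓ
    id   : ∀ {A} → Hom A A
    _∘_  : ∀ {A B C} → Hom B C → Hom A B → Hom A C
    identityˡ : ∀ {A B} {f : Hom A B} → id ∘ f ≡ f
    identityʳ : ∀ {A B} {f : Hom A B} → f ∘ id ≡ f
    assoc : ∀ {A B C D} {f : Hom A B} {g : Hom B C} {h : Hom C D} →
            (h ∘ g) ∘ f ≡ h ∘ (g ∘ f)

module _ {o ℓ} (C : Category o ℓ) where
  open Category C

  record IsPullback {P A B Z : Obj} (f : Hom A Z) (g : Hom B Z)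
                    (p₁ : Hom P A) (p₂ : Hom P B) : Set (o ⊔ ℓ) where
    field
      commute   : f ∘ p₁ ≡ g ∘ p₂
      universal : ∀ {Q} (a : Hom Q A) (b : Hom Q B) → f ∘ a ≡ g ∘ b →
                  Σ (Hom Q P) λ h → (p₁ ∘ h ≡ a) ∧ (p₂ ∘ h ≡ b)
      unique    : ∀ {Q} (h h' : Hom Q P) → p₁ ∘ h ≡ p₁ ∘ h' → p₂ ∘ h ≡ p₂ ∘ h' → h ≡ h'

  record Pullback {A B Z : Obj} (f : Hom A Z) (g : Hom B Z) : Set (o ⊔ ℓ) where
    field
      P  : Obj
      p₁ : Hom P A
      p₂ : Hom P B
      isPullback : IsPullback f g p₁ p₂
    open IsPullback isPullback public

  record IsProduct {P A B : Obj} (π₁ : Hom P A) (π₂ : Hom P B) : Set (o ⊔ ℓ) where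
    field
      universal : ∀ {Q} (a : Hom Q A) (b : Hom Q B) →
                  Σ (Hom Q P) λ h → (π₁ ∘ h ≡ a) ∧ (π₂ ∘ h ≡ b)
      unique    : ∀ {Q} (h h' : Hom Q P) → π₁ ∘ h ≡ π₁ ∘ h' → π₂ ∘ h ≡ π₂ ∘ h' → h ≡ h'

  record Product (A B : Obj) : Set (o ⊔ ℓ) where
    field
      A×B : Obj
      π₁  : Hom A×B A
      π₂  : Hom A×B B
      isProduct : IsProduct π₁ π₂
    open IsProduct isProduct public

  record Terminal : Set (o ⊔ ℓ) where
    field
      ⊤  : Obj
      !  : ∀ {A} → Hom A ⊤
      !-unique : ∀ {A} (h : Hom A ⊤) → h ≡ !

  record FinitelyComplete : Set (o ⊔ ℓ) where
    field
      terminal : Terminal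
      product  : ∀ A B → Product A B
      pullback : ∀ {A B Z} (f : Hom A Z) (g : Hom B Z) → Pullback f g

  record Endofunctor : Set (o ⊔ ℓ) where
    field
      F₀ : Obj → Obj
      F₁ : ∀ {A B} → Hom A B → Hom (F₀ A) (F₀ B)
      identity : ∀ {A} → F₁ (id {A}) ≡ id
      homomorphism : ∀ {A B C} {f : Hom A B} {g : Hom B C} → F₁ (g ∘ f) ≡ F₁ g ∘ F₁ f

  PreservesPullbacks : Endofunctor → Set (o ⊔ ℓ)
  PreservesPullbacks F = ∀ {P A B Z} {f : Hom A Z} {g : Hom B Z} {p₁ : Hom P A} {p₂ : Hom P B} →
    IsPullback f g p₁ p₂ → IsPullback (F₁ f) (F₁ g) (F₁ p₁) (F₁ p₂)
    where open Endofunctor F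

module FinLim {o ℓ} {C : Category o ℓ} (F : FinitelyComplete C) where
  open Category C
  open FinitelyComplete F
  open Terminal terminal public using (⊤; !; !-unique)

  infixr 7 _×_ _×₁_

  _×_ : Obj → Obj → Obj
  A × B = Product.A×B (product A B)

  π₁ : ∀ {A B} → Hom (A × B) A
  π₁ {A} {B} = Product.π₁ (product A B)

  π₂ : ∀ {A B} → Hom (A × B) B
  π₂ {A} {B} = Product.π₂ (product A B)

  ⟨_,_⟩ : ∀ {Q A B} → Hom Q A → Hom Q B → Hom Q (A × B)
  ⟨ a , b ⟩ = proj₁ (Product.universal (product _ _) a b)

  _×₁_ : ∀ {A B A' B'} → Hom A A' → Hom B B' → Hom (A × B) (A' × B')
  f ×₁ g = ⟨ f ∘ π₁ , g ∘ π₂ ⟩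

  assocˣ : ∀ {A B D} → Hom ((A × B) × D) (A × (B × D))
  assocˣ = ⟨ π₁ ∘ π₁ , ⟨ π₂ ∘ π₁ , π₂ ⟩ ⟩

  PB : ∀ {A B Z} → Hom A Z → Hom B Z → Obj
  PB f g = Pullback.P (pullback f g)

  pb₁ : ∀ {A B Z} {f : Hom A Z} {g : Hom B Z} → Hom (PB f g) A
  pb₁ {f = f} {g} = Pullback.p₁ (pullback f g)

  pb₂ : ∀ {A B Z} {f : Hom A Z} {g : Hom B Z} → Hom (PB f g) B
  pb₂ {f = f} {g} = Pullback.p₂ (pullback f g)

  pb-commute : ∀ {A B Z} {f : Hom A Z} {g : Hom B Z} → f ∘ pb₁ {f = f} {g} ≡ g ∘ pb₂
  pb-commute {f = f} {g} = Pullback.commute (pullback f g)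

  ⟨_,_⟩[_] : ∀ {Q A B Z} {f : Hom A Z} {g : Hom B Z} (a : Hom Q A) (b : Hom Q B) →
             f ∘ a ≡ g ∘ b → Hom Q (PB f g)
  ⟨_,_⟩[_] {f = f} {g} a b e = proj₁ (Pullback.universal (pullback f g) a b e)

  pb-β₁ : ∀ {Q A B Z} {f : Hom A Z} {g : Hom B Z} (a : Hom Q A) (b : Hom Q B)
          (e : f ∘ a ≡ g ∘ b) → pb₁ ∘ ⟨ a , b ⟩[ e ] ≡ a
  pb-β₁ {f = f} {g} a b e = proj₁ (proj₂ (Pullback.universal (pullback f g) a b e))

  pb-β₂ : ∀ {Q A B Z} {f : Hom A Z} {g : Hom B Z} (a : Hom Q A) (b : Hom Q B)
          (e : f ∘ a ≡ g ∘ b) → pb₂ ∘ ⟨ a , b ⟩[ e ] ≡ b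
  pb-β₂ {f = f} {g} a b e = proj₂ (proj₂ (Pullback.universal (pullback f g) a b e))

record PathObjectStructure {o ℓ} (C : Category o ℓ) (FC : FinitelyComplete C)
       : Set (o ⊔ ℓ) where
  open Category C
  open FinLim FC
  field
    M    : Endofunctor C
    M-pb : PreservesPullbacks C M
  open Endofunctor M renaming (F₀ to M₀; F₁ to M₁)

  -- Axiom 1: natural transformations s, t, r, m, τ forming an internal
  -- category (X, MX, s, t, r, m) with involution τ.
  field
    s : ∀ X → Hom (M₀ X) X
    t : ∀ X → Hom (M₀ X) X
    r : ∀ X → Hom X (M₀ X)
    τ : ∀ X → Hom (M₀ X) (M₀ X)
    s-natural : ∀ {X Y} (f : Hom X Y) → f ∘ s X ≡ s Y ∘ M₁ f
    t-natural : ∀ {X Y} (f : Hom X Y) → f ∘ t X ≡ t Y ∘ M₁ f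
    r-natural : ∀ {X Y} (f : Hom X Y) → M₁ f ∘ r X ≡ r Y ∘ f
    τ-natural : ∀ {X Y} (f : Hom X Y) → M₁ f ∘ τ X ≡ τ Y ∘ M₁ f

  -- composable pairs MX ×_{s,t} MX
  Comp : Obj → Obj
  Comp X = PB (s X) (t X)

  field
    m : ∀ X → Hom (Comp X) (M₀ X)
    -- naturality of m, stated for the induced map Mf ×_f Mf
    m-natural : ∀ {X Y} (f : Hom X Y) (h : Hom (Comp X) (Comp Y)) →
      pb₁ ∘ h ≡ M₁ f ∘ pb₁ → pb₂ ∘ h ≡ M₁ f ∘ pb₂ →
      M₁ f ∘ m X ≡ m Y ∘ h
    s-r : ∀ X → s X ∘ r X ≡ id
    t-r : ∀ X → t X ∘ r X ≡ id
    s-m : ∀ X → s X ∘ m X ≡ s X ∘ pb₂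
    t-m : ∀ X → t X ∘ m X ≡ t X ∘ pb₁
    m-unitˡ : ∀ X (h : Hom (M₀ X) (Comp X)) →
      pb₁ ∘ h ≡ r X ∘ t X → pb₂ ∘ h ≡ id → m X ∘ h ≡ id
    m-unitʳ : ∀ X (h : Hom (M₀ X) (Comp X)) →
      pb₁ ∘ h ≡ id → pb₂ ∘ h ≡ r X ∘ s X → m X ∘ h ≡ id
    -- associativity, over the object of composable triples
    -- PB pb₂ pb₁ = Comp X ×_{MX} Comp X
    m-assoc : ∀ X (u v : Hom (PB (pb₂ {f = s X} {t X}) (pb₁ {f = s X} {t X})) (Comp X)) →
      pb₁ ∘ u ≡ m X ∘ pb₁ → pb₂ ∘ u ≡ pb₂ ∘ pb₂ →
      pb₁ ∘ v ≡ pb₁ ∘ pb₁ → pb₂ ∘ v ≡ m X ∘ pb₂ →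
      m X ∘ u ≡ m X ∘ v
    -- τ is an involution and an identity-on-objects isomorphism
    -- with the opposite internal category
    τ-invol : ∀ X → τ X ∘ τ X ≡ id
    s-τ : ∀ X → s X ∘ τ X ≡ t X
    t-τ : ∀ X → t X ∘ τ X ≡ s X
    τ-r : ∀ X → τ X ∘ r X ≡ r X
    τ-m : ∀ X (h : Hom (Comp X) (Comp X)) →
      pb₁ ∘ h ≡ τ X ∘ pb₂ → pb₂ ∘ h ≡ τ X ∘ pb₁ →
      τ X ∘ m X ≡ m X ∘ h

  field
    α : ∀ X Y → Hom (M₀ X × Y) (M₀ (X × Y))
    α-natural : ∀ {X X' Y Y'} (f : Hom X X') (g : Hom Y Y') →
      M₁ (f ×₁ g) ∘ α X Y ≡ α X' Y' ∘ (M₁ f ×₁ g)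
    α-unit : ∀ X → M₁ π₁ ∘ α X ⊤ ≡ π₁
    α-assoc : ∀ X Y Z →
      M₁ assocˣ ∘ (α (X × Y) Z ∘ (α X Y ×₁ id)) ≡ α X (Y × Z) ∘ assocˣ
    s-strong : ∀ X Y → s (X × Y) ∘ α X Y ≡ s X ×₁ id
    t-strong : ∀ X Y → t (X × Y) ∘ α X Y ≡ t X ×₁ id
    r-strong : ∀ X Y → r (X × Y) ≡ α X Y ∘ (r X ×₁ id)
    τ-strong : ∀ X Y → τ (X × Y) ∘ α X Y ≡ α X Y ∘ (τ X ×₁ id)
    m-strong : ∀ X Y (h : Hom (Comp X × Y) (Comp (X × Y))) →
      pb₁ ∘ h ≡ α X Y ∘ (pb₁ ×₁ id) → pb₂ ∘ h ≡ α X Y ∘ (pb₂ ×₁ id) →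
      m (X × Y) ∘ h ≡ α X Y ∘ (m X ×₁ id)

  field
    η : ∀ X → Hom (M₀ X) (M₀ (M₀ X))
    η-natural : ∀ {X Y} (f : Hom X Y) → M₁ (M₁ f) ∘ η X ≡ η Y ∘ M₁ f
    η-strong : ∀ X Y →
      η (X × Y) ∘ α X Y ≡ M₁ (α X Y) ∘ (α (M₀ X) Y ∘ (η X ×₁ id))
    s-η : ∀ X → s (M₀ X) ∘ η X ≡ id
    t-η : ∀ X → t (M₀ X) ∘ η X ≡ r X ∘ t X
    Ms-η : ∀ X → M₁ (s X) ∘ η X ≡ id
    -- α₁,X (M!, t) composed with the canonical M(1 × X) ≅ MX
    Mt-η : ∀ X → M₁ (t X) ∘ η X ≡ M₁ π₂ ∘ (α ⊤ X ∘ ⟨ M₁ ! , t X ⟩)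
    η-r : ∀ X → η X ∘ r X ≡ r (M₀ X) ∘ r X

record PathObjectCategory (o ℓ : Level) : Set (lsuc (o ⊔ ℓ)) where
  field
    cat  : Category o ℓ
    finitelyComplete : FinitelyComplete cat
    pathObject : PathObjectStructure cat finitelyComplete

module POC {o ℓ} (E : PathObjectCategory o ℓ) where
  open PathObjectCategory E
  open Category cat public
  open FinLim finitelyComplete public
  open PathObjectStructure pathObject public
  open Endofunctor M public renaming (F₀ to M₀; F₁ to M₁)
  open ≡-Reasoning

  P : ∀ {X Y} → Hom X Y → Obj
  P {X} {Y} f = PB f (t Y)

  e : ∀ {X Y} (f : Hom X Y) → Hom (P f) X
  e f = pb₁

  d : ∀ {X Y} (f : Hom X Y) → Hom (P f) (M₀ Y)
  d f = pb₂

  ρ : ∀ {X Y} (f : Hom X Y) → Hom (P f) Y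
  ρ {Y = Y} f = s Y ∘ d f

  λ-eq : ∀ {X Y} (f : Hom X Y) → f ∘ id ≡ t Y ∘ (r Y ∘ f)
  λ-eq {Y = Y} f = begin
    f ∘ id            ≡⟨ identityʳ ⟩
    f                 ≡⟨ sym identityˡ ⟩
    id ∘ f            ≡⟨ cong (_∘ f) (sym (t-r Y)) ⟩
    (t Y ∘ r Y) ∘ f   ≡⟨ assoc ⟩
    t Y ∘ (r Y ∘ f)   ∎

  λ[_] : ∀ {X Y} (f : Hom X Y) → Hom X (P f)
  λ[ f ] = ⟨ id , r _ ∘ f ⟩[ λ-eq f ]

  record LStr {X Y} (f : Hom X Y) : Set ℓ where
    field
      σ    : Hom Y (P f)
      σ-λ  : σ ∘ f ≡ λ[ f ]
      ρ-σ  : ρ f ∘ σ ≡ id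

  record RStr {X Y} (f : Hom X Y) : Set ℓ where
    field
      p    : Hom (P f) X
      p-λ  : p ∘ λ[ f ] ≡ id
      f-p  : f ∘ p ≡ ρ f

  -- α₁,Γ : M1 × Γ → MΓ  (composed with the canonical M(1 × Γ) ≅ MΓ)
  α₁ : ∀ Γ → Hom (M₀ ⊤ × Γ) (M₀ Γ)
  α₁ Γ = M₁ π₂ ∘ α ⊤ Γ

  MΓ : ∀ {X Γ} → Hom X Γ → Obj
  MΓ {X} {Γ} x = PB (M₁ x) (α₁ Γ)

  j : ∀ {X Γ} (x : Hom X Γ) → Hom (MΓ x) (M₀ X)
  j x = pb₁

  sₓ : ∀ {X Γ} (x : Hom X Γ) → Hom (MΓ x) X
  sₓ {X} x = s X ∘ j x

  tₓ : ∀ {X Γ} (x : Hom X Γ) → Hom (MΓ x) X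
  tₓ {X} x = t X ∘ j x

  π₁-⟨⟩ : ∀ {Q A B} (a : Hom Q A) (b : Hom Q B) → π₁ ∘ ⟨ a , b ⟩ ≡ a
  π₁-⟨⟩ a b = proj₁ (proj₂ (Product.universal (FinitelyComplete.product finitelyComplete _ _) a b))

  π₂-⟨⟩ : ∀ {Q A B} (a : Hom Q A) (b : Hom Q B) → π₂ ∘ ⟨ a , b ⟩ ≡ b
  π₂-⟨⟩ a b = proj₂ (proj₂ (Product.universal (FinitelyComplete.product finitelyComplete _ _) a b))

  ⟨⟩-unique : ∀ {Q A B} (h h' : Hom Q (A × B)) → π₁ ∘ h ≡ π₁ ∘ h' → π₂ ∘ h ≡ π₂ ∘ h' → h ≡ h'
  ⟨⟩-unique = Product.unique (FinitelyComplete.product finitelyComplete _ _)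

  private
    pair-split : ∀ {Q A A' B} (f : Hom A A') (a : Hom Q A) (b : Hom Q B) →
                 ⟨ f ∘ a , b ⟩ ≡ (f ×₁ id) ∘ ⟨ a , b ⟩
    pair-split f a b = ⟨⟩-unique _ _
      (begin
        π₁ ∘ ⟨ f ∘ a , b ⟩            ≡⟨ π₁-⟨⟩ _ _ ⟩
        f ∘ a                          ≡⟨ cong (f ∘_) (sym (π₁-⟨⟩ a b)) ⟩
        f ∘ (π₁ ∘ ⟨ a , b ⟩)           ≡⟨ sym assoc ⟩
        (f ∘ π₁) ∘ ⟨ a , b ⟩           ≡⟨ cong (_∘ ⟨ a , b ⟩) (sym (π₁-⟨⟩ _ _)) ⟩
        (π₁ ∘ (f ×₁ id)) ∘ ⟨ a , b ⟩    ≡⟨ assoc ⟩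
        π₁ ∘ ((f ×₁ id) ∘ ⟨ a , b ⟩)    ∎)
      (begin
        π₂ ∘ ⟨ f ∘ a , b ⟩            ≡⟨ π₂-⟨⟩ _ _ ⟩
        b                              ≡⟨ sym (π₂-⟨⟩ a b) ⟩
        π₂ ∘ ⟨ a , b ⟩                 ≡⟨ cong (_∘ ⟨ a , b ⟩) (sym identityˡ) ⟩
        (id ∘ π₂) ∘ ⟨ a , b ⟩          ≡⟨ cong (_∘ ⟨ a , b ⟩) (sym (π₂-⟨⟩ _ _)) ⟩
        (π₂ ∘ (f ×₁ id)) ∘ ⟨ a , b ⟩    ≡⟨ assoc ⟩
        π₂ ∘ ((f ×₁ id) ∘ ⟨ a , b ⟩)    ∎)

    rₓ-eq : ∀ {X Γ} (x : Hom X Γ) → M₁ x ∘ r X ≡ α₁ Γ ∘ ⟨ r ⊤ ∘ ! , x ⟩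
    rₓ-eq {X} {Γ} x = begin
      M₁ x ∘ r X                                   ≡⟨ r-natural x ⟩
      r Γ ∘ x                                      ≡⟨ cong (r Γ ∘_) (sym (π₂-⟨⟩ ! x)) ⟩
      r Γ ∘ (π₂ ∘ ⟨ ! , x ⟩)                        ≡⟨ sym assoc ⟩
      (r Γ ∘ π₂) ∘ ⟨ ! , x ⟩                        ≡⟨ cong (_∘ ⟨ ! , x ⟩) (sym (r-natural π₂)) ⟩
      (M₁ π₂ ∘ r (⊤ × Γ)) ∘ ⟨ ! , x ⟩               ≡⟨ cong (λ z → (M₁ π₂ ∘ z) ∘ ⟨ ! , x ⟩) (r-strong ⊤ Γ) ⟩
      (M₁ π₂ ∘ (α ⊤ Γ ∘ (r ⊤ ×₁ id))) ∘ ⟨ ! , x ⟩   ≡⟨ cong (_∘ ⟨ ! , x ⟩) (sym assoc) ⟩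
      (α₁ Γ ∘ (r ⊤ ×₁ id)) ∘ ⟨ ! , x ⟩              ≡⟨ assoc ⟩
      α₁ Γ ∘ ((r ⊤ ×₁ id) ∘ ⟨ ! , x ⟩)              ≡⟨ cong (α₁ Γ ∘_) (sym (pair-split (r ⊤) ! x)) ⟩
      α₁ Γ ∘ ⟨ r ⊤ ∘ ! , x ⟩                        ∎

    endpoint-α₁ : (c : ∀ X → Hom (M₀ X) X) →
      (∀ {X Y} (f : Hom X Y) → f ∘ c X ≡ c Y ∘ M₁ f) →
      (∀ X Y → c (X × Y) ∘ α X Y ≡ c X ×₁ id) →
      ∀ Γ → c Γ ∘ α₁ Γ ≡ π₂
    endpoint-α₁ c nat str Γ = begin
      c Γ ∘ (M₁ π₂ ∘ α ⊤ Γ)        ≡⟨ sym assoc ⟩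
      (c Γ ∘ M₁ π₂) ∘ α ⊤ Γ        ≡⟨ cong (_∘ α ⊤ Γ) (sym (nat π₂)) ⟩
      (π₂ ∘ c (⊤ × Γ)) ∘ α ⊤ Γ     ≡⟨ assoc ⟩
      π₂ ∘ (c (⊤ × Γ) ∘ α ⊤ Γ)     ≡⟨ cong (π₂ ∘_) (str ⊤ Γ) ⟩
      π₂ ∘ (c ⊤ ×₁ id)             ≡⟨ π₂-⟨⟩ _ _ ⟩
      id ∘ π₂                      ≡⟨ identityˡ ⟩
      π₂                           ∎

    endpoint-x : (c : ∀ X → Hom (M₀ X) X) →
      (∀ {X Y} (f : Hom X Y) → f ∘ c X ≡ c Y ∘ M₁ f) →
      (∀ X Y → c (X × Y) ∘ α X Y ≡ c X ×₁ id) →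
      ∀ {X Γ} (x : Hom X Γ) → x ∘ (c X ∘ j x) ≡ π₂ ∘ pb₂ {f = M₁ x} {α₁ Γ}
    endpoint-x c nat str {X} {Γ} x = begin
      x ∘ (c X ∘ pb₁)          ≡⟨ sym assoc ⟩
      (x ∘ c X) ∘ pb₁          ≡⟨ cong (_∘ pb₁) (nat x) ⟩
      (c Γ ∘ M₁ x) ∘ pb₁       ≡⟨ assoc ⟩
      c Γ ∘ (M₁ x ∘ pb₁)       ≡⟨ cong (c Γ ∘_) pb-commute ⟩
      c Γ ∘ (α₁ Γ ∘ pb₂)       ≡⟨ sym assoc ⟩
      (c Γ ∘ α₁ Γ) ∘ pb₂       ≡⟨ cong (_∘ pb₂) (endpoint-α₁ c nat str Γ) ⟩
      π₂ ∘ pb₂                 ∎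

  rₓ : ∀ {X Γ} (x : Hom X Γ) → Hom X (MΓ x)
  rₓ {X} x = ⟨ r X , ⟨ r ⊤ ∘ ! , x ⟩ ⟩[ rₓ-eq x ]

  sₓ-tₓ-eq : ∀ {X Γ} (x : Hom X Γ) → x ∘ sₓ x ≡ x ∘ tₓ x
  sₓ-tₓ-eq x = trans (endpoint-x s s-natural s-strong x)
                     (sym (endpoint-x t t-natural t-strong x))

  ⟨sₓ,tₓ⟩ : ∀ {X Γ} (x : Hom X Γ) → Hom (MΓ x) (PB x x)
  ⟨sₓ,tₓ⟩ x = ⟨ sₓ x , tₓ x ⟩[ sₓ-tₓ-eq x ]

  δ : ∀ {X Γ} (x : Hom X Γ) → Hom X (PB x x)
  δ x = ⟨ id , id ⟩[ refl ]

module Submission where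

-- Maps Q → M A are treated as "paths" in A.  A path in X is fibrewise over
-- x when its image under M x is a constant path α₁(u, g); points of M_Γ(x)
-- are exactly the fibrewise paths, and j_x is monic.

open import Defs
open import Data.Product using (Σ; _,_; proj₁; proj₂) renaming (_×_ to _∧_)
open import Relation.Binary.PropositionalEquality
  using (_≡_; refl; sym; trans; cong; cong₂; module ≡-Reasoning)

module CategoryFacts {o ℓ} (C : Category o ℓ) where
  open Category C

  pullˡ : ∀ {A B C D} {a : Hom C D} {b : Hom B C} {c : Hom B D} {f : Hom A B} →
          a ∘ b ≡ c → a ∘ (b ∘ f) ≡ c ∘ f
  pullˡ {f = f} eq = trans (sym assoc) (cong (_∘ f) eq)

  pullʳ : ∀ {A B C D} {a : Hom B C} {b : Hom A B} {c : Hom A C} {f : Hom C D} →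
          a ∘ b ≡ c → (f ∘ a) ∘ b ≡ f ∘ c
  pullʳ {f = f} eq = trans assoc (cong (f ∘_) eq)

module LimitFacts {o ℓ} {C : Category o ℓ} (FC : FinitelyComplete C) where
  open Category C
  open CategoryFacts C
  open FinLim FC
  open FinitelyComplete FC using (product; pullback)

  !-unique₂ : ∀ {A} (h h' : Hom A ⊤) → h ≡ h'
  !-unique₂ h h' = trans (!-unique h) (sym (!-unique h'))

  π₁-⟨⟩ : ∀ {Q A B} (a : Hom Q A) (b : Hom Q B) → π₁ ∘ ⟨ a , b ⟩ ≡ a
  π₁-⟨⟩ a b = proj₁ (proj₂ (Product.universal (product _ _) a b))

  π₂-⟨⟩ : ∀ {Q A B} (a : Hom Q A) (b : Hom Q B) → π₂ ∘ ⟨ a , b ⟩ ≡ b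
  π₂-⟨⟩ a b = proj₂ (proj₂ (Product.universal (product _ _) a b))

  ⟨⟩-unique : ∀ {Q A B} (h h' : Hom Q (A × B)) →
              π₁ ∘ h ≡ π₁ ∘ h' → π₂ ∘ h ≡ π₂ ∘ h' → h ≡ h'
  ⟨⟩-unique = Product.unique (product _ _)

  ⟨⟩-∘ : ∀ {Q Q' A B} (a : Hom Q A) (b : Hom Q B) (h : Hom Q' Q) →
         ⟨ a , b ⟩ ∘ h ≡ ⟨ a ∘ h , b ∘ h ⟩
  ⟨⟩-∘ a b h = ⟨⟩-unique _ _ (trans (pullˡ (π₁-⟨⟩ a b)) (sym (π₁-⟨⟩ _ _)))
                             (trans (pullˡ (π₂-⟨⟩ a b)) (sym (π₂-⟨⟩ _ _)))

  ×₁-⟨⟩ : ∀ {Q A B A' B'} (f : Hom A A') (g : Hom B B') (a : Hom Q A) (b : Hom Q B) →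
          (f ×₁ g) ∘ ⟨ a , b ⟩ ≡ ⟨ f ∘ a , g ∘ b ⟩
  ×₁-⟨⟩ f g a b = trans (⟨⟩-∘ _ _ _)
    (cong₂ ⟨_,_⟩ (pullʳ (π₁-⟨⟩ a b)) (pullʳ (π₂-⟨⟩ a b)))

  ⟨⟩-η : ∀ {Q A B} (h : Hom Q (A × B)) → ⟨ π₁ ∘ h , π₂ ∘ h ⟩ ≡ h
  ⟨⟩-η h = ⟨⟩-unique _ _ (π₁-⟨⟩ _ _) (π₂-⟨⟩ _ _)

  ⟨π₁,π₂⟩ : ∀ {A B} → ⟨ π₁ , π₂ ⟩ ≡ id {A × B}
  ⟨π₁,π₂⟩ = trans (cong₂ ⟨_,_⟩ (sym identityʳ) (sym identityʳ)) (⟨⟩-η id)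

  π₂-×₁id : ∀ {A A' B} (f : Hom A A') → π₂ ∘ (f ×₁ id {B}) ≡ π₂
  π₂-×₁id f = trans (π₂-⟨⟩ _ _) identityˡ

  module _ {A B Z : Obj} {f : Hom A Z} {g : Hom B Z} where
    pb-unique : ∀ {Q} (h h' : Hom Q (PB f g)) →
                pb₁ ∘ h ≡ pb₁ ∘ h' → pb₂ ∘ h ≡ pb₂ ∘ h' → h ≡ h'
    pb-unique = Pullback.unique (pullback f g)

    pb-ext : ∀ {Q} (h : Hom Q (PB f g)) {a : Hom Q A} {b : Hom Q B} (eq : f ∘ a ≡ g ∘ b) →
             pb₁ ∘ h ≡ a → pb₂ ∘ h ≡ b → h ≡ ⟨ a , b ⟩[ eq ]
    pb-ext h eq e₁ e₂ = pb-unique _ _ (trans e₁ (sym (pb-β₁ _ _ eq)))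
                                      (trans e₂ (sym (pb-β₂ _ _ eq)))

    pair-cong : ∀ {Q} {a a' : Hom Q A} {b b' : Hom Q B}
                (eq : f ∘ a ≡ g ∘ b) (eq' : f ∘ a' ≡ g ∘ b') →
                a ≡ a' → b ≡ b' → ⟨ a , b ⟩[ eq ] ≡ ⟨ a' , b' ⟩[ eq' ]
    pair-cong eq eq' e₁ e₂ = pb-ext _ eq' (trans (pb-β₁ _ _ eq) e₁) (trans (pb-β₂ _ _ eq) e₂)

    pair-∘ : ∀ {Q Q'} (a : Hom Q A) (b : Hom Q B) (eq : f ∘ a ≡ g ∘ b) (h : Hom Q' Q)
             (eq' : f ∘ (a ∘ h) ≡ g ∘ (b ∘ h)) →
             ⟨ a , b ⟩[ eq ] ∘ h ≡ ⟨ a ∘ h , b ∘ h ⟩[ eq' ]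
    pair-∘ a b eq h eq' = pb-ext _ eq' (pullˡ (pb-β₁ _ _ eq)) (pullˡ (pb-β₂ _ _ eq))

module PreservedPullbacks {o ℓ} {C : Category o ℓ} (FC : FinitelyComplete C)
       (F : Endofunctor C) (F-pb : PreservesPullbacks C F) where
  open Category C
  open FinLim FC
  open Endofunctor F
  open FinitelyComplete FC using (pullback)

  module _ {A B Z : Obj} {f : Hom A Z} {g : Hom B Z} where
    private
      F-isPullback = F-pb (Pullback.isPullback (pullback f g))

    Fpair : ∀ {Q} (a : Hom Q (F₀ A)) (b : Hom Q (F₀ B)) → F₁ f ∘ a ≡ F₁ g ∘ b →
            Hom Q (F₀ (PB f g))
    Fpair a b eq = proj₁ (IsPullback.universal F-isPullback a b eq)

    Fpair-β₁ : ∀ {Q} (a : Hom Q (F₀ A)) (b : Hom Q (F₀ B)) (eq : F₁ f ∘ a ≡ F₁ g ∘ b) →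
               F₁ pb₁ ∘ Fpair a b eq ≡ a
    Fpair-β₁ a b eq = proj₁ (proj₂ (IsPullback.universal F-isPullback a b eq))

    Fpair-β₂ : ∀ {Q} (a : Hom Q (F₀ A)) (b : Hom Q (F₀ B)) (eq : F₁ f ∘ a ≡ F₁ g ∘ b) →
               F₁ pb₂ ∘ Fpair a b eq ≡ b
    Fpair-β₂ a b eq = proj₂ (proj₂ (IsPullback.universal F-isPullback a b eq))

    Fpair-unique : ∀ {Q} (h h' : Hom Q (F₀ (PB f g))) →
                   F₁ pb₁ ∘ h ≡ F₁ pb₁ ∘ h' → F₁ pb₂ ∘ h ≡ F₁ pb₂ ∘ h' → h ≡ h'
    Fpair-unique = IsPullback.unique F-isPullback

    Fpair-ext : ∀ {Q} (h : Hom Q (F₀ (PB f g))) {a b} (eq : F₁ f ∘ a ≡ F₁ g ∘ b) →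
                F₁ pb₁ ∘ h ≡ a → F₁ pb₂ ∘ h ≡ b → h ≡ Fpair a b eq
    Fpair-ext h eq e₁ e₂ = Fpair-unique _ _ (trans e₁ (sym (Fpair-β₁ _ _ eq)))
                                            (trans e₂ (sym (Fpair-β₂ _ _ eq)))

module PathObjectTheory {o ℓ} (E : PathObjectCategory o ℓ) where
  open PathObjectCategory E using (cat; finitelyComplete)
  open POC E hiding (π₁-⟨⟩; π₂-⟨⟩; ⟨⟩-unique)
  open CategoryFacts cat
  open LimitFacts finitelyComplete
  open PreservedPullbacks finitelyComplete M M-pb
    renaming (Fpair to Mpair; Fpair-β₁ to Mpair-β₁; Fpair-β₂ to Mpair-β₂;
              Fpair-unique to Mpair-unique; Fpair-ext to Mpair-ext)
  open ≡-Reasoning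

  -- Composition of paths, on generalised elements.  compose a b is
  -- "first b, then a": it starts where b starts and ends where a ends.
  compose : ∀ {Q A} (a b : Hom Q (M₀ A)) → s A ∘ a ≡ t A ∘ b → Hom Q (M₀ A)
  compose {A = A} a b eq = m A ∘ ⟨ a , b ⟩[ eq ]

  compose-s : ∀ {Q A} (a b : Hom Q (M₀ A)) (eq : s A ∘ a ≡ t A ∘ b) →
              s A ∘ compose a b eq ≡ s A ∘ b
  compose-s {A = A} a b eq = trans (pullˡ (s-m A)) (pullʳ (pb-β₂ _ _ eq))

  compose-t : ∀ {Q A} (a b : Hom Q (M₀ A)) (eq : s A ∘ a ≡ t A ∘ b) →
              t A ∘ compose a b eq ≡ t A ∘ a
  compose-t {A = A} a b eq = trans (pullˡ (t-m A)) (pullʳ (pb-β₁ _ _ eq))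

  compose-cong : ∀ {Q A} {a a' b b' : Hom Q (M₀ A)}
                 (eq : s A ∘ a ≡ t A ∘ b) (eq' : s A ∘ a' ≡ t A ∘ b') →
                 a ≡ a' → b ≡ b' → compose a b eq ≡ compose a' b' eq'
  compose-cong eq eq' e₁ e₂ = cong (m _ ∘_) (pair-cong eq eq' e₁ e₂)

  composable-∘ : ∀ {Q Q' A} {a b : Hom Q (M₀ A)} (eq : s A ∘ a ≡ t A ∘ b) (h : Hom Q' Q) →
                 s A ∘ (a ∘ h) ≡ t A ∘ (b ∘ h)
  composable-∘ eq h = trans (pullˡ eq) assoc

  compose-∘ : ∀ {Q Q' A} (a b : Hom Q (M₀ A)) (eq : s A ∘ a ≡ t A ∘ b) (h : Hom Q' Q) →
              compose a b eq ∘ h ≡ compose (a ∘ h) (b ∘ h) (composable-∘ eq h)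
  compose-∘ a b eq h = pullʳ (pair-∘ a b eq h (composable-∘ eq h))

  unitʳ-composable : ∀ {Q A} (a : Hom Q (M₀ A)) → s A ∘ a ≡ t A ∘ (r A ∘ (s A ∘ a))
  unitʳ-composable {A = A} a = sym (trans (pullˡ (t-r A)) identityˡ)

  unitˡ-composable : ∀ {Q A} (b : Hom Q (M₀ A)) → s A ∘ (r A ∘ (t A ∘ b)) ≡ t A ∘ b
  unitˡ-composable {A = A} b = trans (pullˡ (s-r A)) identityˡ

  compose-unitʳ : ∀ {Q A} (a : Hom Q (M₀ A)) →
                  compose a (r A ∘ (s A ∘ a)) (unitʳ-composable a) ≡ a
  compose-unitʳ {A = A} a = begin
      m A ∘ ⟨ a , r A ∘ (s A ∘ a) ⟩[ unitʳ-composable a ]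
        ≡⟨ cong (m A ∘_) (sym (pb-ext (unit ∘ a) (unitʳ-composable a)
             (trans (pullˡ (pb-β₁ _ _ e₀)) identityˡ) (trans (pullˡ (pb-β₂ _ _ e₀)) assoc))) ⟩
      m A ∘ (unit ∘ a)       ≡⟨ pullˡ (m-unitʳ A unit (pb-β₁ _ _ e₀) (pb-β₂ _ _ e₀)) ⟩
      id ∘ a                 ≡⟨ identityˡ ⟩
      a                      ∎
    where
      e₀ : s A ∘ id ≡ t A ∘ (r A ∘ s A)
      e₀ = trans identityʳ (sym (trans (pullˡ (t-r A)) identityˡ))
      unit : Hom (M₀ A) (Comp A)
      unit = ⟨ id , r A ∘ s A ⟩[ e₀ ]

  compose-unitˡ : ∀ {Q A} (b : Hom Q (M₀ A)) →
                  compose (r A ∘ (t A ∘ b)) b (unitˡ-composable b) ≡ b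
  compose-unitˡ {A = A} b = begin
      m A ∘ ⟨ r A ∘ (t A ∘ b) , b ⟩[ unitˡ-composable b ]
        ≡⟨ cong (m A ∘_) (sym (pb-ext (unit ∘ b) (unitˡ-composable b)
             (trans (pullˡ (pb-β₁ _ _ e₀)) assoc) (trans (pullˡ (pb-β₂ _ _ e₀)) identityˡ))) ⟩
      m A ∘ (unit ∘ b)       ≡⟨ pullˡ (m-unitˡ A unit (pb-β₁ _ _ e₀) (pb-β₂ _ _ e₀)) ⟩
      id ∘ b                 ≡⟨ identityˡ ⟩
      b                      ∎
    where
      e₀ : s A ∘ (r A ∘ t A) ≡ t A ∘ id
      e₀ = trans (pullˡ (s-r A)) (trans identityˡ (sym identityʳ))
      unit : Hom (M₀ A) (Comp A)
      unit = ⟨ r A ∘ t A , id ⟩[ e₀ ]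

  composable-M : ∀ {Q A B} (f : Hom A B) {a b : Hom Q (M₀ A)} → s A ∘ a ≡ t A ∘ b →
                 s B ∘ (M₁ f ∘ a) ≡ t B ∘ (M₁ f ∘ b)
  composable-M {A = A} {B} f {a} {b} eq = begin
    s B ∘ (M₁ f ∘ a)   ≡⟨ pullˡ (sym (s-natural f)) ⟩
    (f ∘ s A) ∘ a      ≡⟨ pullʳ eq ⟩
    f ∘ (t A ∘ b)      ≡⟨ pullˡ (t-natural f) ⟩
    (t B ∘ M₁ f) ∘ b   ≡⟨ assoc ⟩
    t B ∘ (M₁ f ∘ b)   ∎

  compose-natural : ∀ {Q A B} (f : Hom A B) (a b : Hom Q (M₀ A)) (eq : s A ∘ a ≡ t A ∘ b) →
                    M₁ f ∘ compose a b eq ≡ compose (M₁ f ∘ a) (M₁ f ∘ b) (composable-M f eq)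
  compose-natural {A = A} {B} f a b eq = begin
      M₁ f ∘ (m A ∘ ⟨ a , b ⟩[ eq ])
        ≡⟨ pullˡ (m-natural f Mf² (pb-β₁ _ _ e₀) (pb-β₂ _ _ e₀)) ⟩
      (m B ∘ Mf²) ∘ ⟨ a , b ⟩[ eq ]
        ≡⟨ pullʳ (pb-ext _ (composable-M f eq)
             (trans (pullˡ (pb-β₁ _ _ e₀)) (pullʳ (pb-β₁ _ _ eq)))
             (trans (pullˡ (pb-β₂ _ _ e₀)) (pullʳ (pb-β₂ _ _ eq)))) ⟩
      m B ∘ ⟨ M₁ f ∘ a , M₁ f ∘ b ⟩[ composable-M f eq ] ∎
    where
      e₀ : s B ∘ (M₁ f ∘ pb₁) ≡ t B ∘ (M₁ f ∘ pb₂ {f = s A} {g = t A})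
      e₀ = composable-M f pb-commute
      Mf² : Hom (Comp A) (Comp B)
      Mf² = ⟨ M₁ f ∘ pb₁ , M₁ f ∘ pb₂ ⟩[ e₀ ]

  -- Constant paths.  α₁ Γ (u , g) is the constant path at g, parametrised
  -- by a path u in the terminal object.

  α₁-endpoint : (c : ∀ X → Hom (M₀ X) X) →
    (∀ {X Y} (f : Hom X Y) → f ∘ c X ≡ c Y ∘ M₁ f) →
    (∀ X Y → c (X × Y) ∘ α X Y ≡ c X ×₁ id) →
    ∀ Γ → c Γ ∘ α₁ Γ ≡ π₂
  α₁-endpoint c natural strong Γ = begin
    c Γ ∘ (M₁ π₂ ∘ α ⊤ Γ)        ≡⟨ pullˡ (sym (natural π₂)) ⟩
    (π₂ ∘ c (⊤ × Γ)) ∘ α ⊤ Γ     ≡⟨ pullʳ (strong ⊤ Γ) ⟩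
    π₂ ∘ (c ⊤ ×₁ id)             ≡⟨ π₂-×₁id _ ⟩
    π₂                           ∎

  s-α₁ : ∀ Γ → s Γ ∘ α₁ Γ ≡ π₂
  s-α₁ = α₁-endpoint s s-natural s-strong

  t-α₁ : ∀ Γ → t Γ ∘ α₁ Γ ≡ π₂
  t-α₁ = α₁-endpoint t t-natural t-strong

  α₁-natural : ∀ {A B} (f : Hom A B) → M₁ f ∘ α₁ A ≡ α₁ B ∘ (id ×₁ f)
  α₁-natural {A} {B} f = begin
    M₁ f ∘ (M₁ π₂ ∘ α ⊤ A)              ≡⟨ pullˡ (sym homomorphism) ⟩
    M₁ (f ∘ π₂) ∘ α ⊤ A                 ≡⟨ cong (λ z → M₁ z ∘ α ⊤ A) (sym (π₂-⟨⟩ _ _)) ⟩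
    M₁ (π₂ ∘ (id ×₁ f)) ∘ α ⊤ A         ≡⟨ cong (_∘ α ⊤ A) homomorphism ⟩
    (M₁ π₂ ∘ M₁ (id ×₁ f)) ∘ α ⊤ A      ≡⟨ pullʳ (α-natural id f) ⟩
    M₁ π₂ ∘ (α ⊤ B ∘ (M₁ id ×₁ f))      ≡⟨ cong (λ z → M₁ π₂ ∘ (α ⊤ B ∘ (z ×₁ f))) identity ⟩
    M₁ π₂ ∘ (α ⊤ B ∘ (id ×₁ f))         ≡⟨ sym assoc ⟩
    α₁ B ∘ (id ×₁ f)                    ∎

  α₁-natural-⟨⟩ : ∀ {Q A B} (f : Hom A B) (u : Hom Q (M₀ ⊤)) (g : Hom Q A) →
                  M₁ f ∘ (α₁ A ∘ ⟨ u , g ⟩) ≡ α₁ B ∘ ⟨ u , f ∘ g ⟩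
  α₁-natural-⟨⟩ f u g = trans (pullˡ (α₁-natural f))
    (pullʳ (trans (×₁-⟨⟩ _ _ _ _) (cong ⟨_, f ∘ g ⟩ identityˡ)))

  τ-α₁ : ∀ Γ → τ Γ ∘ α₁ Γ ≡ α₁ Γ ∘ (τ ⊤ ×₁ id)
  τ-α₁ Γ = begin
    τ Γ ∘ (M₁ π₂ ∘ α ⊤ Γ)          ≡⟨ pullˡ (sym (τ-natural π₂)) ⟩
    (M₁ π₂ ∘ τ (⊤ × Γ)) ∘ α ⊤ Γ    ≡⟨ pullʳ (τ-strong ⊤ Γ) ⟩
    M₁ π₂ ∘ (α ⊤ Γ ∘ (τ ⊤ ×₁ id))  ≡⟨ sym assoc ⟩
    α₁ Γ ∘ (τ ⊤ ×₁ id)             ∎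

  M!-α₁ : ∀ Γ → M₁ ! ∘ α₁ Γ ≡ π₁
  M!-α₁ Γ = begin
    M₁ ! ∘ (M₁ π₂ ∘ α ⊤ Γ)          ≡⟨ pullˡ (sym homomorphism) ⟩
    M₁ (! ∘ π₂) ∘ α ⊤ Γ             ≡⟨ cong (λ z → M₁ z ∘ α ⊤ Γ) (!-unique₂ _ (π₁ ∘ (id ×₁ !))) ⟩
    M₁ (π₁ ∘ (id ×₁ !)) ∘ α ⊤ Γ     ≡⟨ cong (_∘ α ⊤ Γ) homomorphism ⟩
    (M₁ π₁ ∘ M₁ (id ×₁ !)) ∘ α ⊤ Γ  ≡⟨ pullʳ (α-natural id !) ⟩
    M₁ π₁ ∘ (α ⊤ ⊤ ∘ (M₁ id ×₁ !))  ≡⟨ pullˡ (α-unit ⊤) ⟩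
    π₁ ∘ (M₁ id ×₁ !)               ≡⟨ π₁-⟨⟩ _ _ ⟩
    M₁ id ∘ π₁                      ≡⟨ cong (_∘ π₁) identity ⟩
    id ∘ π₁                         ≡⟨ identityˡ ⟩
    π₁                              ∎

  α₁-retraction : ∀ Γ → ⟨ M₁ ! , s Γ ⟩ ∘ α₁ Γ ≡ id
  α₁-retraction Γ = trans (⟨⟩-∘ _ _ _) (trans (cong₂ ⟨_,_⟩ (M!-α₁ Γ) (s-α₁ Γ)) ⟨π₁,π₂⟩)

  Mt-η-α₁ : ∀ X → M₁ (t X) ∘ η X ≡ α₁ X ∘ ⟨ M₁ ! , t X ⟩
  Mt-η-α₁ X = trans (Mt-η X) (sym assoc)

  η-α₁ : ∀ Γ → η Γ ∘ α₁ Γ ≡ M₁ (α₁ Γ) ∘ (α (M₀ ⊤) Γ ∘ (η ⊤ ×₁ id))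
  η-α₁ Γ = begin
    η Γ ∘ (M₁ π₂ ∘ α ⊤ Γ)                    ≡⟨ pullˡ (sym (η-natural π₂)) ⟩
    (M₁ (M₁ π₂) ∘ η (⊤ × Γ)) ∘ α ⊤ Γ         ≡⟨ pullʳ (η-strong ⊤ Γ) ⟩
    M₁ (M₁ π₂) ∘ (M₁ (α ⊤ Γ) ∘ (α (M₀ ⊤) Γ ∘ (η ⊤ ×₁ id)))
                                             ≡⟨ pullˡ (sym homomorphism) ⟩
    M₁ (α₁ Γ) ∘ (α (M₀ ⊤) Γ ∘ (η ⊤ ×₁ id))   ∎

  -- Constant paths over a common point compose to a constant path: the
  -- composite of α₁(u, g) and α₁(v, g) is α₁(u · v, g).
  α₁-composable : ∀ Γ → s Γ ∘ (α₁ Γ ∘ (pb₁ {f = s ⊤} {g = t ⊤} ×₁ id))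
                      ≡ t Γ ∘ (α₁ Γ ∘ (pb₂ ×₁ id))
  α₁-composable Γ = trans (pullˡ (s-α₁ Γ))
    (trans (π₂-×₁id _) (sym (trans (pullˡ (t-α₁ Γ)) (π₂-×₁id _))))

  m-α₁ : ∀ Γ → m Γ ∘ ⟨ α₁ Γ ∘ (pb₁ ×₁ id) , α₁ Γ ∘ (pb₂ ×₁ id) ⟩[ α₁-composable Γ ]
             ≡ α₁ Γ ∘ (m ⊤ ×₁ id)
  m-α₁ Γ = begin
      m Γ ∘ ⟨ α₁ Γ ∘ (pb₁ ×₁ id) , α₁ Γ ∘ (pb₂ ×₁ id) ⟩[ α₁-composable Γ ]
        ≡⟨ cong (m Γ ∘_) (sym (pb-ext _ (α₁-composable Γ)
             (trans (trans (pullˡ (pb-β₁ _ _ eπ)) (pullʳ (pb-β₁ _ _ eα))) (sym assoc))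
             (trans (trans (pullˡ (pb-β₂ _ _ eπ)) (pullʳ (pb-β₂ _ _ eα))) (sym assoc)))) ⟩
      m Γ ∘ (Mπ₂² ∘ strength)
        ≡⟨ pullˡ (sym (m-natural π₂ Mπ₂² (pb-β₁ _ _ eπ) (pb-β₂ _ _ eπ))) ⟩
      (M₁ π₂ ∘ m (⊤ × Γ)) ∘ strength
        ≡⟨ pullʳ (m-strong ⊤ Γ strength (pb-β₁ _ _ eα) (pb-β₂ _ _ eα)) ⟩
      M₁ π₂ ∘ (α ⊤ Γ ∘ (m ⊤ ×₁ id))
        ≡⟨ sym assoc ⟩
      α₁ Γ ∘ (m ⊤ ×₁ id) ∎
    where
      eα : s (⊤ × Γ) ∘ (α ⊤ Γ ∘ (pb₁ ×₁ id)) ≡ t (⊤ × Γ) ∘ (α ⊤ Γ ∘ (pb₂ ×₁ id))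
      eα = trans (pullˡ (s-strong ⊤ Γ)) (trans (⟨⟩-unique _ _ (!-unique₂ _ _)
             (trans (pullˡ (π₂-×₁id _)) (trans (π₂-×₁id _)
               (sym (trans (pullˡ (π₂-×₁id _)) (π₂-×₁id _))))))
             (sym (pullˡ (t-strong ⊤ Γ))))
      strength : Hom (Comp ⊤ × Γ) (Comp (⊤ × Γ))
      strength = ⟨ α ⊤ Γ ∘ (pb₁ ×₁ id) , α ⊤ Γ ∘ (pb₂ ×₁ id) ⟩[ eα ]
      eπ : s Γ ∘ (M₁ π₂ ∘ pb₁) ≡ t Γ ∘ (M₁ π₂ ∘ pb₂ {f = s (⊤ × Γ)} {g = t (⊤ × Γ)})
      eπ = composable-M π₂ pb-commute
      Mπ₂² : Hom (Comp (⊤ × Γ)) (Comp Γ)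
      Mπ₂² = ⟨ M₁ π₂ ∘ pb₁ , M₁ π₂ ∘ pb₂ ⟩[ eπ ]

  compose-α₁ : ∀ {Q Γ} (ka kb : Hom Q (M₀ ⊤ × Γ)) → π₂ ∘ ka ≡ π₂ ∘ kb →
               (eq : s Γ ∘ (α₁ Γ ∘ ka) ≡ t Γ ∘ (α₁ Γ ∘ kb)) →
               Σ (Hom Q (M₀ ⊤ × Γ)) λ k → compose (α₁ Γ ∘ ka) (α₁ Γ ∘ kb) eq ≡ α₁ Γ ∘ k
  compose-α₁ {Q} {Γ} ka kb same eq = (m ⊤ ×₁ id) ∘ w , (begin
      m Γ ∘ ⟨ α₁ Γ ∘ ka , α₁ Γ ∘ kb ⟩[ eq ]
        ≡⟨ cong (m Γ ∘_) (sym (pb-ext _ eq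
             (trans (pullˡ (pb-β₁ _ _ _)) (pullʳ (component pb₁ ka (pb-β₁ _ _ _) refl)))
             (trans (pullˡ (pb-β₂ _ _ _)) (pullʳ (component pb₂ kb (pb-β₂ _ _ _) same))))) ⟩
      m Γ ∘ (⟨ α₁ Γ ∘ (pb₁ ×₁ id) , α₁ Γ ∘ (pb₂ ×₁ id) ⟩[ α₁-composable Γ ] ∘ w)
        ≡⟨ pullˡ (m-α₁ Γ) ⟩
      (α₁ Γ ∘ (m ⊤ ×₁ id)) ∘ w
        ≡⟨ assoc ⟩
      α₁ Γ ∘ ((m ⊤ ×₁ id) ∘ w) ∎)
    where
      w : Hom Q (Comp ⊤ × Γ)
      w = ⟨ ⟨ π₁ ∘ ka , π₁ ∘ kb ⟩[ !-unique₂ _ _ ] , π₂ ∘ ka ⟩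
      component : ∀ (q : Hom (Comp ⊤) (M₀ ⊤)) (k : Hom Q (M₀ ⊤ × Γ)) →
                  q ∘ ⟨ π₁ ∘ ka , π₁ ∘ kb ⟩[ !-unique₂ _ _ ] ≡ π₁ ∘ k → π₂ ∘ ka ≡ π₂ ∘ k →
                  (q ×₁ id) ∘ w ≡ k
      component q k e₁ e₂ = trans (×₁-⟨⟩ _ _ _ _)
        (trans (cong₂ ⟨_,_⟩ e₁ (trans identityˡ e₂)) (⟨⟩-η k))

  -- Fibrewise paths.  A path a in X is fibrewise over x : X → Γ when its
  -- image M x ∘ a is a constant path; M_Γ(x) classifies such paths.
  module FibrewisePaths {X Γ : Obj} (x : Hom X Γ) where

    Fibrewise : ∀ {Q} → Hom Q (M₀ X) → Set ℓ
    Fibrewise {Q} a = Σ (Hom Q (M₀ ⊤ × Γ)) λ k → M₁ x ∘ a ≡ α₁ Γ ∘ k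

    τ-fibrewise : ∀ {Q} (a : Hom Q (M₀ X)) → Fibrewise a → Fibrewise (τ X ∘ a)
    τ-fibrewise a (k , fib) = (τ ⊤ ×₁ id) ∘ k ,
      trans (pullˡ (τ-natural x)) (trans (pullʳ fib) (trans (pullˡ (τ-α₁ Γ)) assoc))

    compose-fibrewise : ∀ {Q} (a b : Hom Q (M₀ X)) (eq : s X ∘ a ≡ t X ∘ b) →
                        Fibrewise a → Fibrewise b → Fibrewise (compose a b eq)
    compose-fibrewise {Q} a b eq (ka , fa) (kb , fb) =
      proj₁ composite , trans image (proj₂ composite)
      where
        -- both constant paths sit over the same point, x (s a) = x (t b)
        same : π₂ ∘ ka ≡ π₂ ∘ kb
        same = begin
          π₂ ∘ ka                ≡⟨ cong (_∘ ka) (sym (s-α₁ Γ)) ⟩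
          (s Γ ∘ α₁ Γ) ∘ ka      ≡⟨ pullʳ (sym fa) ⟩
          s Γ ∘ (M₁ x ∘ a)       ≡⟨ pullˡ (sym (s-natural x)) ⟩
          (x ∘ s X) ∘ a          ≡⟨ pullʳ eq ⟩
          x ∘ (t X ∘ b)          ≡⟨ pullˡ (t-natural x) ⟩
          (t Γ ∘ M₁ x) ∘ b       ≡⟨ pullʳ fb ⟩
          t Γ ∘ (α₁ Γ ∘ kb)      ≡⟨ pullˡ (t-α₁ Γ) ⟩
          π₂ ∘ kb                ∎
        eqα : s Γ ∘ (α₁ Γ ∘ ka) ≡ t Γ ∘ (α₁ Γ ∘ kb)
        eqα = trans (pullˡ (s-α₁ Γ)) (trans same (sym (pullˡ (t-α₁ Γ))))
        composite : Σ (Hom Q (M₀ ⊤ × Γ)) λ k →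
                    compose (α₁ Γ ∘ ka) (α₁ Γ ∘ kb) eqα ≡ α₁ Γ ∘ k
        composite = compose-α₁ ka kb same eqα
        image : M₁ x ∘ compose a b eq ≡ compose (α₁ Γ ∘ ka) (α₁ Γ ∘ kb) eqα
        image = trans (compose-natural x a b eq) (compose-cong _ eqα fa fb)

    jₓ : Hom (MΓ x) (M₀ X)
    jₓ = j x

    kₓ : Hom (MΓ x) (M₀ ⊤ × Γ)
    kₓ = pb₂ {f = M₁ x} {g = α₁ Γ}

    -- the parameter of a point of M_Γ(x) is determined by its path,
    -- since α₁ Γ has the retraction ⟨ M ! , s Γ ⟩
    kₓ-determined : ∀ {Q} (h : Hom Q (MΓ x)) → kₓ ∘ h ≡ ⟨ M₁ ! , s Γ ⟩ ∘ (M₁ x ∘ (jₓ ∘ h))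
    kₓ-determined h = begin
      kₓ ∘ h                                    ≡⟨ sym identityˡ ⟩
      id ∘ (kₓ ∘ h)                             ≡⟨ cong (_∘ (kₓ ∘ h)) (sym (α₁-retraction Γ)) ⟩
      (⟨ M₁ ! , s Γ ⟩ ∘ α₁ Γ) ∘ (kₓ ∘ h)        ≡⟨ pullʳ (pullˡ (sym pb-commute)) ⟩
      ⟨ M₁ ! , s Γ ⟩ ∘ ((M₁ x ∘ jₓ) ∘ h)        ≡⟨ cong (⟨ M₁ ! , s Γ ⟩ ∘_) assoc ⟩
      ⟨ M₁ ! , s Γ ⟩ ∘ (M₁ x ∘ (jₓ ∘ h))        ∎

    j-mono : ∀ {Q} (h h' : Hom Q (MΓ x)) → jₓ ∘ h ≡ jₓ ∘ h' → h ≡ h'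
    j-mono h h' eq = pb-unique h h' eq (begin
      kₓ ∘ h                                ≡⟨ kₓ-determined h ⟩
      ⟨ M₁ ! , s Γ ⟩ ∘ (M₁ x ∘ (jₓ ∘ h))    ≡⟨ cong (λ z → ⟨ M₁ ! , s Γ ⟩ ∘ (M₁ x ∘ z)) eq ⟩
      ⟨ M₁ ! , s Γ ⟩ ∘ (M₁ x ∘ (jₓ ∘ h'))   ≡⟨ sym (kₓ-determined h') ⟩
      kₓ ∘ h'                               ∎)

    classify : ∀ {Q} (a : Hom Q (M₀ X)) → Fibrewise a → Hom Q (MΓ x)
    classify a (k , fib) = ⟨ a , k ⟩[ fib ]

    j-classify : ∀ {Q} (a : Hom Q (M₀ X)) (fib : Fibrewise a) → jₓ ∘ classify a fib ≡ a
    j-classify a (k , fib) = pb-β₁ a k fib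

    x-sₓ : x ∘ sₓ x ≡ π₂ ∘ kₓ
    x-sₓ = begin
      x ∘ (s X ∘ jₓ)         ≡⟨ pullˡ (s-natural x) ⟩
      (s Γ ∘ M₁ x) ∘ jₓ      ≡⟨ pullʳ pb-commute ⟩
      s Γ ∘ (α₁ Γ ∘ kₓ)      ≡⟨ pullˡ (s-α₁ Γ) ⟩
      π₂ ∘ kₓ                ∎

    j-rₓ : jₓ ∘ rₓ x ≡ r X
    j-rₓ = pb-β₁ _ _ _

    k-rₓ : kₓ ∘ rₓ x ≡ ⟨ r ⊤ ∘ ! , x ⟩
    k-rₓ = pb-β₂ _ _ _

    diagonal-factorisation : ⟨sₓ,tₓ⟩ x ∘ rₓ x ≡ δ x
    diagonal-factorisation = pb-ext _ refl
      (trans (pullˡ (pb-β₁ _ _ _)) (trans (pullʳ j-rₓ) (s-r X)))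
      (trans (pullˡ (pb-β₂ _ _ _)) (trans (pullʳ j-rₓ) (t-r X)))

  -- The L-structure on r_x: a point φ of M_Γ(x) is sent to its target
  -- together with the path of paths η φ contracting φ onto r (t φ); the
  -- strength of η makes this path of paths again fibrewise.
  module ContractionStructure {X Γ : Obj} (x : Hom X Γ) where
    open FibrewisePaths x

    contraction-composable :
      M₁ (M₁ x) ∘ (η X ∘ jₓ) ≡ M₁ (α₁ Γ) ∘ (α (M₀ ⊤) Γ ∘ ((η ⊤ ×₁ id) ∘ kₓ))
    contraction-composable = begin
      M₁ (M₁ x) ∘ (η X ∘ jₓ)        ≡⟨ pullˡ (η-natural x) ⟩
      (η Γ ∘ M₁ x) ∘ jₓ             ≡⟨ pullʳ pb-commute ⟩
      η Γ ∘ (α₁ Γ ∘ kₓ)             ≡⟨ pullˡ (η-α₁ Γ) ⟩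
      (M₁ (α₁ Γ) ∘ (α (M₀ ⊤) Γ ∘ (η ⊤ ×₁ id))) ∘ kₓ ≡⟨ pullʳ assoc ⟩
      M₁ (α₁ Γ) ∘ (α (M₀ ⊤) Γ ∘ ((η ⊤ ×₁ id) ∘ kₓ)) ∎

    contraction : Hom (MΓ x) (M₀ (MΓ x))
    contraction = Mpair (η X ∘ jₓ) (α (M₀ ⊤) Γ ∘ ((η ⊤ ×₁ id) ∘ kₓ)) contraction-composable

    j-contraction : M₁ jₓ ∘ contraction ≡ η X ∘ jₓ
    j-contraction = Mpair-β₁ _ _ contraction-composable

    contraction-s : s (MΓ x) ∘ contraction ≡ id
    contraction-s = j-mono _ _ (begin
      jₓ ∘ (s (MΓ x) ∘ contraction)     ≡⟨ pullˡ (s-natural jₓ) ⟩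
      (s (M₀ X) ∘ M₁ jₓ) ∘ contraction  ≡⟨ pullʳ j-contraction ⟩
      s (M₀ X) ∘ (η X ∘ jₓ)             ≡⟨ pullˡ (s-η X) ⟩
      id ∘ jₓ                           ≡⟨ identityˡ ⟩
      jₓ                                ≡⟨ sym identityʳ ⟩
      jₓ ∘ id                           ∎)

    contraction-t : rₓ x ∘ tₓ x ≡ t (MΓ x) ∘ contraction
    contraction-t = j-mono _ _ (begin
      jₓ ∘ (rₓ x ∘ tₓ x)                ≡⟨ pullˡ j-rₓ ⟩
      r X ∘ (t X ∘ jₓ)                  ≡⟨ sym assoc ⟩
      (r X ∘ t X) ∘ jₓ                  ≡⟨ cong (_∘ jₓ) (sym (t-η X)) ⟩
      (t (M₀ X) ∘ η X) ∘ jₓ             ≡⟨ pullʳ (sym j-contraction) ⟩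
      t (M₀ X) ∘ (M₁ jₓ ∘ contraction)  ≡⟨ pullˡ (sym (t-natural jₓ)) ⟩
      (jₓ ∘ t (MΓ x)) ∘ contraction     ≡⟨ assoc ⟩
      jₓ ∘ (t (MΓ x) ∘ contraction)     ∎)

    contraction-r : contraction ∘ rₓ x ≡ r (MΓ x) ∘ rₓ x
    contraction-r = Mpair-unique _ _
      (begin
        M₁ jₓ ∘ (contraction ∘ rₓ x)   ≡⟨ pullˡ j-contraction ⟩
        (η X ∘ jₓ) ∘ rₓ x              ≡⟨ pullʳ j-rₓ ⟩
        η X ∘ r X                      ≡⟨ η-r X ⟩
        r (M₀ X) ∘ r X                 ≡⟨ cong (r (M₀ X) ∘_) (sym j-rₓ) ⟩
        r (M₀ X) ∘ (jₓ ∘ rₓ x)         ≡⟨ pullˡ (sym (r-natural jₓ)) ⟩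
        (M₁ jₓ ∘ r (MΓ x)) ∘ rₓ x      ≡⟨ assoc ⟩
        M₁ jₓ ∘ (r (MΓ x) ∘ rₓ x)      ∎)
      (begin
        M₁ kₓ ∘ (contraction ∘ rₓ x)   ≡⟨ pullˡ (Mpair-β₂ _ _ contraction-composable) ⟩
        (α (M₀ ⊤) Γ ∘ ((η ⊤ ×₁ id) ∘ kₓ)) ∘ rₓ x      ≡⟨ pullʳ (pullʳ k-rₓ) ⟩
        α (M₀ ⊤) Γ ∘ ((η ⊤ ×₁ id) ∘ ⟨ r ⊤ ∘ ! , x ⟩)  ≡⟨ cong (α (M₀ ⊤) Γ ∘_) η-on-constant ⟩
        α (M₀ ⊤) Γ ∘ ((r (M₀ ⊤) ×₁ id) ∘ ⟨ r ⊤ ∘ ! , x ⟩)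
                                       ≡⟨ pullˡ (sym (r-strong (M₀ ⊤) Γ)) ⟩
        r (M₀ ⊤ × Γ) ∘ ⟨ r ⊤ ∘ ! , x ⟩ ≡⟨ cong (r (M₀ ⊤ × Γ) ∘_) (sym k-rₓ) ⟩
        r (M₀ ⊤ × Γ) ∘ (kₓ ∘ rₓ x)     ≡⟨ pullˡ (sym (r-natural kₓ)) ⟩
        (M₁ kₓ ∘ r (MΓ x)) ∘ rₓ x      ≡⟨ assoc ⟩
        M₁ kₓ ∘ (r (MΓ x) ∘ rₓ x)      ∎)
      where
        η-on-constant : (η ⊤ ×₁ id) ∘ ⟨ r ⊤ ∘ ! , x ⟩ ≡ (r (M₀ ⊤) ×₁ id) ∘ ⟨ r ⊤ ∘ ! , x ⟩
        η-on-constant = trans (×₁-⟨⟩ _ _ _ _)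
          (trans (cong (⟨_, id ∘ x ⟩) (trans (pullˡ (η-r ⊤)) assoc)) (sym (×₁-⟨⟩ _ _ _ _)))

    rₓ-LStr : LStr (rₓ x)
    rₓ-LStr = record
      { σ   = ⟨ tₓ x , contraction ⟩[ contraction-t ]
      ; σ-λ = pb-ext _ (λ-eq (rₓ x))
          (trans (pullˡ (pb-β₁ _ _ contraction-t)) (trans (pullʳ j-rₓ) (t-r X)))
          (trans (pullˡ (pb-β₂ _ _ contraction-t)) contraction-r)
      ; ρ-σ = trans (pullʳ (pb-β₂ _ _ contraction-t)) contraction-s
      }

  -- The R-structure on x moves a point
  -- a of X back along a path ω of Γ ending at x a, to a point over the
  -- start of ω.  Applied pointwise it gives
  --   connecting ψ    : a fibrewise path from the transport of t ψ along
  --                     x ψ to s ψ, for any path ψ of X;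
  --   transported φ γ : a fibrewise path φ over the end of γ, moved back
  --                     along γ.
  module Transport {X Γ : Obj} (x : Hom X Γ) (rx : RStr x) where
    open RStr rx renaming (p to transport; p-λ to transport-λ; f-p to x-transport)
    open FibrewisePaths x

    endOf-eq : ∀ {Q} (ψ : Hom Q (M₀ X)) → x ∘ (t X ∘ ψ) ≡ t Γ ∘ (M₁ x ∘ ψ)
    endOf-eq ψ = trans (pullˡ (t-natural x)) assoc

    endOf : ∀ {Q} (ψ : Hom Q (M₀ X)) → Hom Q (P x)
    endOf ψ = ⟨ t X ∘ ψ , M₁ x ∘ ψ ⟩[ endOf-eq ψ ]

    -- For a path a, the path of paths whose i-th member is the segment of
    -- x a from x (s a) to x ((τ a) i); it runs from x a to the constant path
    -- at x (s a), and pairs with τ a into a path of P x.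
    shrinking : Hom (M₀ X) (M₀ (M₀ Γ))
    shrinking = M₁ (τ Γ) ∘ (η Γ ∘ (τ Γ ∘ M₁ x))

    shrinking-t-composable : M₁ x ∘ τ X ≡ M₁ (t Γ) ∘ shrinking
    shrinking-t-composable = begin
      M₁ x ∘ τ X                          ≡⟨ τ-natural x ⟩
      τ Γ ∘ M₁ x                          ≡⟨ sym identityˡ ⟩
      id ∘ (τ Γ ∘ M₁ x)                   ≡⟨ cong (_∘ (τ Γ ∘ M₁ x)) (sym (Ms-η Γ)) ⟩
      (M₁ (s Γ) ∘ η Γ) ∘ (τ Γ ∘ M₁ x)     ≡⟨ assoc ⟩
      M₁ (s Γ) ∘ (η Γ ∘ (τ Γ ∘ M₁ x))     ≡⟨ cong (_∘ (η Γ ∘ (τ Γ ∘ M₁ x))) (sym Mt-Mτ) ⟩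
      (M₁ (t Γ) ∘ M₁ (τ Γ)) ∘ (η Γ ∘ (τ Γ ∘ M₁ x)) ≡⟨ assoc ⟩
      M₁ (t Γ) ∘ shrinking                ∎
      where
        Mt-Mτ : M₁ (t Γ) ∘ M₁ (τ Γ) ≡ M₁ (s Γ)
        Mt-Mτ = trans (sym homomorphism) (cong M₁ (t-τ Γ))

    shrinking-s : s (M₀ Γ) ∘ shrinking ≡ M₁ x
    shrinking-s = begin
      s (M₀ Γ) ∘ (M₁ (τ Γ) ∘ (η Γ ∘ (τ Γ ∘ M₁ x)))  ≡⟨ pullˡ (sym (s-natural (τ Γ))) ⟩
      (τ Γ ∘ s (M₀ Γ)) ∘ (η Γ ∘ (τ Γ ∘ M₁ x))       ≡⟨ pullʳ (pullˡ (s-η Γ)) ⟩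
      τ Γ ∘ (id ∘ (τ Γ ∘ M₁ x))                     ≡⟨ cong (τ Γ ∘_) identityˡ ⟩
      τ Γ ∘ (τ Γ ∘ M₁ x)                            ≡⟨ pullˡ (τ-invol Γ) ⟩
      id ∘ M₁ x                                     ≡⟨ identityˡ ⟩
      M₁ x                                          ∎

    shrinking-t : t (M₀ Γ) ∘ shrinking ≡ r Γ ∘ (x ∘ s X)
    shrinking-t = begin
      t (M₀ Γ) ∘ (M₁ (τ Γ) ∘ (η Γ ∘ (τ Γ ∘ M₁ x)))  ≡⟨ pullˡ (sym (t-natural (τ Γ))) ⟩
      (τ Γ ∘ t (M₀ Γ)) ∘ (η Γ ∘ (τ Γ ∘ M₁ x))       ≡⟨ pullʳ (pullˡ (t-η Γ)) ⟩
      τ Γ ∘ ((r Γ ∘ t Γ) ∘ (τ Γ ∘ M₁ x))            ≡⟨ cong (τ Γ ∘_) (pullʳ (pullˡ (t-τ Γ))) ⟩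
      τ Γ ∘ (r Γ ∘ (s Γ ∘ M₁ x))                    ≡⟨ pullˡ (τ-r Γ) ⟩
      r Γ ∘ (s Γ ∘ M₁ x)                            ≡⟨ cong (r Γ ∘_) (sym (s-natural x)) ⟩
      r Γ ∘ (x ∘ s X)                               ∎

    shrinking-r : shrinking ∘ r X ≡ r (M₀ Γ) ∘ (r Γ ∘ x)
    shrinking-r = begin
      (M₁ (τ Γ) ∘ (η Γ ∘ (τ Γ ∘ M₁ x))) ∘ r X   ≡⟨ pullʳ (pullʳ (pullʳ (r-natural x))) ⟩
      M₁ (τ Γ) ∘ (η Γ ∘ (τ Γ ∘ (r Γ ∘ x)))       ≡⟨ cong (λ z → M₁ (τ Γ) ∘ (η Γ ∘ z)) (pullˡ (τ-r Γ)) ⟩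
      M₁ (τ Γ) ∘ (η Γ ∘ (r Γ ∘ x))               ≡⟨ cong (M₁ (τ Γ) ∘_) (pullˡ (η-r Γ)) ⟩
      M₁ (τ Γ) ∘ ((r (M₀ Γ) ∘ r Γ) ∘ x)          ≡⟨ cong (M₁ (τ Γ) ∘_) assoc ⟩
      M₁ (τ Γ) ∘ (r (M₀ Γ) ∘ (r Γ ∘ x))          ≡⟨ pullˡ (r-natural (τ Γ)) ⟩
      (r (M₀ Γ) ∘ τ Γ) ∘ (r Γ ∘ x)               ≡⟨ pullʳ (pullˡ (τ-r Γ)) ⟩
      r (M₀ Γ) ∘ (r Γ ∘ x)                       ∎

    shrinkingLift : Hom (M₀ X) (M₀ (P x))
    shrinkingLift = Mpair (τ X) shrinking shrinking-t-composable

    shrinkingLift-s : s (P x) ∘ shrinkingLift ≡ ⟨ t X , M₁ x ⟩[ t-natural x ]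
    shrinkingLift-s = pb-ext _ (t-natural x)
      (trans (pullˡ (s-natural (e x))) (trans (pullʳ (Mpair-β₁ _ _ _)) (s-τ X)))
      (trans (pullˡ (s-natural (d x))) (trans (pullʳ (Mpair-β₂ _ _ _)) shrinking-s))

    shrinkingLift-t : t (P x) ∘ shrinkingLift ≡ λ[ x ] ∘ s X
    shrinkingLift-t = pb-unique _ _
      (trans (pullˡ (t-natural (e x))) (trans (pullʳ (Mpair-β₁ _ _ _))
         (trans (t-τ X) (sym (trans (pullˡ (pb-β₁ _ _ _)) identityˡ)))))
      (trans (pullˡ (t-natural (d x))) (trans (pullʳ (Mpair-β₂ _ _ _))
         (trans shrinking-t (sym (trans (pullˡ (pb-β₂ _ _ _)) assoc)))))

    shrinkingLift-r : shrinkingLift ∘ r X ≡ r (P x) ∘ λ[ x ]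
    shrinkingLift-r = Mpair-unique _ _
      (trans (pullˡ (Mpair-β₁ _ _ _)) (trans (τ-r X) (sym (trans (pullˡ (r-natural (e x)))
         (trans (pullʳ (pb-β₁ _ _ _)) identityʳ)))))
      (trans (pullˡ (Mpair-β₂ _ _ _)) (trans shrinking-r (sym (trans (pullˡ (r-natural (d x)))
         (pullʳ (pb-β₂ _ _ _))))))

    connecting : Hom (M₀ X) (M₀ X)
    connecting = M₁ transport ∘ shrinkingLift

    connecting-s : ∀ {Q} (ψ : Hom Q (M₀ X)) → s X ∘ (connecting ∘ ψ) ≡ transport ∘ endOf ψ
    connecting-s ψ = begin
      s X ∘ (M₁ transport ∘ shrinkingLift) ∘ ψ   ≡⟨ pullˡ (pullˡ (sym (s-natural transport))) ⟩
      ((transport ∘ s (P x)) ∘ shrinkingLift) ∘ ψ ≡⟨ cong (_∘ ψ) (pullʳ shrinkingLift-s) ⟩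
      (transport ∘ ⟨ t X , M₁ x ⟩[ t-natural x ]) ∘ ψ
                                                 ≡⟨ pullʳ (pair-∘ _ _ _ ψ (endOf-eq ψ)) ⟩
      transport ∘ endOf ψ                        ∎

    connecting-t : ∀ {Q} (ψ : Hom Q (M₀ X)) → t X ∘ (connecting ∘ ψ) ≡ s X ∘ ψ
    connecting-t ψ = pullˡ (begin
      t X ∘ (M₁ transport ∘ shrinkingLift)   ≡⟨ pullˡ (sym (t-natural transport)) ⟩
      (transport ∘ t (P x)) ∘ shrinkingLift  ≡⟨ pullʳ shrinkingLift-t ⟩
      transport ∘ (λ[ x ] ∘ s X)             ≡⟨ pullˡ transport-λ ⟩
      id ∘ s X                               ≡⟨ identityˡ ⟩
      s X                                    ∎)

    -- the image of connecting ψ is a reparametrised constant path,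
    -- because x ∘ transport = s ∘ d
    x-connecting : M₁ x ∘ connecting ≡ α₁ Γ ∘ ⟨ M₁ ! ∘ (τ Γ ∘ M₁ x) , s Γ ∘ M₁ x ⟩
    x-connecting = begin
      M₁ x ∘ (M₁ transport ∘ shrinkingLift)  ≡⟨ pullˡ (sym homomorphism) ⟩
      M₁ (x ∘ transport) ∘ shrinkingLift     ≡⟨ cong (λ z → M₁ z ∘ shrinkingLift) x-transport ⟩
      M₁ (s Γ ∘ d x) ∘ shrinkingLift         ≡⟨ cong (_∘ shrinkingLift) homomorphism ⟩
      (M₁ (s Γ) ∘ M₁ (d x)) ∘ shrinkingLift  ≡⟨ pullʳ (Mpair-β₂ _ _ _) ⟩
      M₁ (s Γ) ∘ shrinking                   ≡⟨ pullˡ (trans (sym homomorphism) (cong M₁ (s-τ Γ))) ⟩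
      M₁ (t Γ) ∘ (η Γ ∘ (τ Γ ∘ M₁ x))        ≡⟨ pullˡ (Mt-η-α₁ Γ) ⟩
      (α₁ Γ ∘ ⟨ M₁ ! , t Γ ⟩) ∘ (τ Γ ∘ M₁ x) ≡⟨ pullʳ (⟨⟩-∘ _ _ _) ⟩
      α₁ Γ ∘ ⟨ M₁ ! ∘ (τ Γ ∘ M₁ x) , t Γ ∘ (τ Γ ∘ M₁ x) ⟩
              ≡⟨ cong (λ z → α₁ Γ ∘ ⟨ M₁ ! ∘ (τ Γ ∘ M₁ x) , z ⟩) (pullˡ (t-τ Γ)) ⟩
      α₁ Γ ∘ ⟨ M₁ ! ∘ (τ Γ ∘ M₁ x) , s Γ ∘ M₁ x ⟩ ∎

    connecting-fibrewise : ∀ {Q} (ψ : Hom Q (M₀ X)) → Fibrewise (connecting ∘ ψ)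
    connecting-fibrewise ψ = _ , trans (pullˡ x-connecting) assoc

    connecting-r : connecting ∘ r X ≡ r X
    connecting-r = trans (pullʳ shrinkingLift-r)
      (trans (pullˡ (r-natural transport)) (trans (pullʳ transport-λ) identityʳ))

    module Transported {Q : Obj} (φ : Hom Q (M₀ X)) (u : Hom Q (M₀ ⊤)) (γ : Hom Q (M₀ Γ))
                       (φ-fib : M₁ x ∘ φ ≡ α₁ Γ ∘ ⟨ u , t Γ ∘ γ ⟩) where

      constantAtγ : Hom Q (M₀ (M₀ Γ))
      constantAtγ = α₁ (M₀ Γ) ∘ ⟨ u , γ ⟩

      pairing-eq : M₁ x ∘ φ ≡ M₁ (t Γ) ∘ constantAtγ
      pairing-eq = trans φ-fib (sym (α₁-natural-⟨⟩ (t Γ) u γ))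

      liftedPair : Hom Q (M₀ (P x))
      liftedPair = Mpair φ constantAtγ pairing-eq

      transported : Hom Q (M₀ X)
      transported = M₁ transport ∘ liftedPair

      transported-endpoint : (c : ∀ X → Hom (M₀ X) X) →
        (∀ {X Y} (f : Hom X Y) → f ∘ c X ≡ c Y ∘ M₁ f) →
        c (M₀ Γ) ∘ α₁ (M₀ Γ) ≡ π₂ → (eq : x ∘ (c X ∘ φ) ≡ t Γ ∘ γ) →
        c X ∘ transported ≡ transport ∘ ⟨ c X ∘ φ , γ ⟩[ eq ]
      transported-endpoint c natural c-α₁ eq =
        trans (pullˡ (sym (natural transport))) (pullʳ (pb-ext _ eq
          (trans (pullˡ (natural (e x))) (pullʳ (Mpair-β₁ _ _ pairing-eq)))
          (trans (pullˡ (natural (d x))) (trans (pullʳ (Mpair-β₂ _ _ pairing-eq))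
             (trans (pullˡ c-α₁) (π₂-⟨⟩ _ _))))))

      transported-fibrewise : M₁ x ∘ transported ≡ α₁ Γ ∘ ⟨ u , s Γ ∘ γ ⟩
      transported-fibrewise = begin
        M₁ x ∘ (M₁ transport ∘ liftedPair)    ≡⟨ pullˡ (sym homomorphism) ⟩
        M₁ (x ∘ transport) ∘ liftedPair       ≡⟨ cong (λ z → M₁ z ∘ liftedPair) x-transport ⟩
        M₁ (s Γ ∘ d x) ∘ liftedPair           ≡⟨ cong (_∘ liftedPair) homomorphism ⟩
        (M₁ (s Γ) ∘ M₁ (d x)) ∘ liftedPair    ≡⟨ pullʳ (Mpair-β₂ _ _ pairing-eq) ⟩
        M₁ (s Γ) ∘ constantAtγ                ≡⟨ α₁-natural-⟨⟩ (s Γ) u γ ⟩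
        α₁ Γ ∘ ⟨ u , s Γ ∘ γ ⟩                ∎

      transported-r : (g : Hom Q Γ) → γ ≡ r Γ ∘ g → transported ≡ φ
      transported-r g γ-r = begin
          M₁ transport ∘ liftedPair
            ≡⟨ cong (M₁ transport ∘_) (sym (Mpair-ext (M₁ λ[ x ] ∘ φ) pairing-eq e-λφ d-λφ)) ⟩
          M₁ transport ∘ (M₁ λ[ x ] ∘ φ)  ≡⟨ pullˡ (sym homomorphism) ⟩
          M₁ (transport ∘ λ[ x ]) ∘ φ     ≡⟨ cong (λ z → M₁ z ∘ φ) transport-λ ⟩
          M₁ id ∘ φ                       ≡⟨ cong (_∘ φ) identity ⟩
          id ∘ φ                          ≡⟨ identityˡ ⟩
          φ                               ∎
        where
          e-λφ : M₁ (e x) ∘ (M₁ λ[ x ] ∘ φ) ≡ φ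
          e-λφ = trans (pullˡ (sym homomorphism)) (trans (cong (λ z → M₁ z ∘ φ) (pb-β₁ _ _ _))
                   (trans (cong (_∘ φ) identity) identityˡ))
          γ-rt : r Γ ∘ (t Γ ∘ γ) ≡ γ
          γ-rt = trans (cong (λ z → r Γ ∘ (t Γ ∘ z)) γ-r)
                   (trans (cong (r Γ ∘_) (trans (pullˡ (t-r Γ)) identityˡ)) (sym γ-r))
          d-λφ : M₁ (d x) ∘ (M₁ λ[ x ] ∘ φ) ≡ constantAtγ
          d-λφ = begin
            M₁ (d x) ∘ (M₁ λ[ x ] ∘ φ)   ≡⟨ pullˡ (sym homomorphism) ⟩
            M₁ (d x ∘ λ[ x ]) ∘ φ        ≡⟨ cong (λ z → M₁ z ∘ φ) (pb-β₂ _ _ _) ⟩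
            M₁ (r Γ ∘ x) ∘ φ             ≡⟨ cong (_∘ φ) homomorphism ⟩
            (M₁ (r Γ) ∘ M₁ x) ∘ φ        ≡⟨ pullʳ φ-fib ⟩
            M₁ (r Γ) ∘ (α₁ Γ ∘ ⟨ u , t Γ ∘ γ ⟩) ≡⟨ α₁-natural-⟨⟩ (r Γ) u (t Γ ∘ γ) ⟩
            α₁ (M₀ Γ) ∘ ⟨ u , r Γ ∘ (t Γ ∘ γ) ⟩ ≡⟨ cong (λ z → α₁ (M₀ Γ) ∘ ⟨ u , z ⟩) γ-rt ⟩
            constantAtγ                  ∎

    open Transported public

    transported-∘ : ∀ {Q Q'} (φ : Hom Q (M₀ X)) (u : Hom Q (M₀ ⊤)) (γ : Hom Q (M₀ Γ))
      (φ-fib : M₁ x ∘ φ ≡ α₁ Γ ∘ ⟨ u , t Γ ∘ γ ⟩) (h : Hom Q' Q)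
      (φh-fib : M₁ x ∘ (φ ∘ h) ≡ α₁ Γ ∘ ⟨ u ∘ h , t Γ ∘ (γ ∘ h) ⟩) →
      transported φ u γ φ-fib ∘ h ≡ transported (φ ∘ h) (u ∘ h) (γ ∘ h) φh-fib
    transported-∘ φ u γ φ-fib h φh-fib = pullʳ (Mpair-ext _ (pairing-eq (φ ∘ h) (u ∘ h) (γ ∘ h) φh-fib)
      (pullˡ (Mpair-β₁ _ _ _))
      (trans (pullˡ (Mpair-β₂ _ _ _)) (pullʳ (⟨⟩-∘ _ _ _))))

  -- A generalised point
  -- of P(s_x,t_x) is a fibrewise path φ (a point of M_Γ(x)) together with a
  -- path (ψ₁, ψ₂) of X ×_Γ X ending at (s φ, t φ) and lying over γ.  Its
  -- lift is the fibrewise path  κ₂ · φ' · κ₁⁻¹  from s ψ₁ to s ψ₂, where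
  -- φ' is φ transported back along γ and κᵢ = connecting ψᵢ.
  module LiftingStructure {X Γ : Obj} (x : Hom X Γ) (rx : RStr x) where
    open RStr rx using () renaming (p to transport)
    open FibrewisePaths x
    open Transport x rx

    ⟨s,t⟩ : Hom (MΓ x) (PB x x)
    ⟨s,t⟩ = ⟨sₓ,tₓ⟩ x

    pr₁ pr₂ : Hom (PB x x) X
    pr₁ = pb₁
    pr₂ = pb₂

    eQ : Hom (P ⟨s,t⟩) (MΓ x)
    eQ = e ⟨s,t⟩

    dQ : Hom (P ⟨s,t⟩) (M₀ (PB x x))
    dQ = d ⟨s,t⟩

    φ ψ₁ ψ₂ : Hom (P ⟨s,t⟩) (M₀ X)
    φ  = jₓ ∘ eQ
    ψ₁ = M₁ pr₁ ∘ dQ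
    ψ₂ = M₁ pr₂ ∘ dQ

    u : Hom (P ⟨s,t⟩) (M₀ ⊤)
    u = π₁ ∘ (kₓ ∘ eQ)

    γ : Hom (P ⟨s,t⟩) (M₀ Γ)
    γ = M₁ x ∘ ψ₁

    end-ψ : ∀ (pr : Hom (PB x x) X) (c : Hom (MΓ x) X) → pr ∘ ⟨s,t⟩ ≡ c →
            t X ∘ (M₁ pr ∘ dQ) ≡ c ∘ eQ
    end-ψ pr c pr-st = begin
      t X ∘ (M₁ pr ∘ dQ)        ≡⟨ pullˡ (sym (t-natural pr)) ⟩
      (pr ∘ t (PB x x)) ∘ dQ    ≡⟨ pullʳ (sym pb-commute) ⟩
      pr ∘ (⟨s,t⟩ ∘ eQ)         ≡⟨ pullˡ pr-st ⟩
      c ∘ eQ                    ∎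

    t-ψ₁ : t X ∘ ψ₁ ≡ s X ∘ φ
    t-ψ₁ = trans (end-ψ pr₁ (sₓ x) (pb-β₁ _ _ _)) assoc

    t-ψ₂ : t X ∘ ψ₂ ≡ t X ∘ φ
    t-ψ₂ = trans (end-ψ pr₂ (tₓ x) (pb-β₂ _ _ _)) assoc

    x-ψ₂ : M₁ x ∘ ψ₂ ≡ γ
    x-ψ₂ = trans (pullˡ (sym homomorphism)) (trans (cong (λ z → M₁ z ∘ dQ) (sym pb-commute))
             (trans (cong (_∘ dQ) homomorphism) assoc))

    t-γ : t Γ ∘ γ ≡ π₂ ∘ (kₓ ∘ eQ)
    t-γ = begin
      t Γ ∘ (M₁ x ∘ ψ₁)       ≡⟨ pullˡ (sym (t-natural x)) ⟩
      (x ∘ t X) ∘ ψ₁          ≡⟨ pullʳ t-ψ₁ ⟩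
      x ∘ (s X ∘ (jₓ ∘ eQ))   ≡⟨ cong (x ∘_) (sym assoc) ⟩
      x ∘ (sₓ x ∘ eQ)         ≡⟨ pullˡ x-sₓ ⟩
      (π₂ ∘ kₓ) ∘ eQ          ≡⟨ assoc ⟩
      π₂ ∘ (kₓ ∘ eQ)          ∎

    φ-fib : M₁ x ∘ φ ≡ α₁ Γ ∘ ⟨ u , t Γ ∘ γ ⟩
    φ-fib = trans (pullˡ pb-commute) (pullʳ
              (trans (sym (⟨⟩-η _)) (cong ⟨ u ,_⟩ (sym t-γ))))

    κ₁ κ₂ φ' : Hom (P ⟨s,t⟩) (M₀ X)
    κ₁ = connecting ∘ ψ₁
    κ₂ = connecting ∘ ψ₂
    φ' = transported φ u γ φ-fib

    s-φ' : s X ∘ φ' ≡ t X ∘ (τ X ∘ κ₁)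
    s-φ' = begin
      s X ∘ φ'                              ≡⟨ transported-endpoint φ u γ φ-fib s s-natural (s-α₁ (M₀ Γ)) e₁ ⟩
      transport ∘ ⟨ s X ∘ φ , γ ⟩[ e₁ ]     ≡⟨ cong (transport ∘_) (pair-cong e₁ (endOf-eq ψ₁) (sym t-ψ₁) refl) ⟩
      transport ∘ endOf ψ₁                  ≡⟨ sym (connecting-s ψ₁) ⟩
      s X ∘ κ₁                              ≡⟨ sym (pullˡ (t-τ X)) ⟩
      t X ∘ (τ X ∘ κ₁)                      ∎
      where
        e₁ : x ∘ (s X ∘ φ) ≡ t Γ ∘ γ
        e₁ = trans (cong (x ∘_) (sym t-ψ₁)) (endOf-eq ψ₁)

    φ'κ₁⁻¹ : Hom (P ⟨s,t⟩) (M₀ X)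
    φ'κ₁⁻¹ = compose φ' (τ X ∘ κ₁) s-φ'

    s-κ₂ : s X ∘ κ₂ ≡ t X ∘ φ'κ₁⁻¹
    s-κ₂ = begin
      s X ∘ κ₂                              ≡⟨ connecting-s ψ₂ ⟩
      transport ∘ endOf ψ₂                  ≡⟨ cong (transport ∘_) (pair-cong (endOf-eq ψ₂) e₂ t-ψ₂ x-ψ₂) ⟩
      transport ∘ ⟨ t X ∘ φ , γ ⟩[ e₂ ]     ≡⟨ sym (transported-endpoint φ u γ φ-fib t t-natural (t-α₁ (M₀ Γ)) e₂) ⟩
      t X ∘ φ'                              ≡⟨ sym (compose-t _ _ s-φ') ⟩
      t X ∘ φ'κ₁⁻¹                          ∎
      where
        e₂ : x ∘ (t X ∘ φ) ≡ t Γ ∘ γ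
        e₂ = trans (cong (x ∘_) (sym t-ψ₂)) (trans (endOf-eq ψ₂) (cong (t Γ ∘_) x-ψ₂))

    liftedPath : Hom (P ⟨s,t⟩) (M₀ X)
    liftedPath = compose κ₂ φ'κ₁⁻¹ s-κ₂

    liftedPath-fibrewise : Fibrewise liftedPath
    liftedPath-fibrewise = compose-fibrewise κ₂ φ'κ₁⁻¹ s-κ₂ (connecting-fibrewise ψ₂)
      (compose-fibrewise φ' (τ X ∘ κ₁) s-φ' (_ , transported-fibrewise φ u γ φ-fib)
        (τ-fibrewise κ₁ (connecting-fibrewise ψ₁)))

    liftedPath-s : s X ∘ liftedPath ≡ s X ∘ ψ₁
    liftedPath-s = begin
      s X ∘ liftedPath        ≡⟨ compose-s _ _ s-κ₂ ⟩
      s X ∘ φ'κ₁⁻¹            ≡⟨ compose-s _ _ s-φ' ⟩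
      s X ∘ (τ X ∘ κ₁)        ≡⟨ pullˡ (s-τ X) ⟩
      t X ∘ κ₁                ≡⟨ connecting-t ψ₁ ⟩
      s X ∘ ψ₁                ∎

    liftedPath-t : t X ∘ liftedPath ≡ s X ∘ ψ₂
    liftedPath-t = trans (compose-t _ _ s-κ₂) (connecting-t ψ₂)

    lift : Hom (P ⟨s,t⟩) (MΓ x)
    lift = classify liftedPath liftedPath-fibrewise

    j-lift : jₓ ∘ lift ≡ liftedPath
    j-lift = j-classify liftedPath liftedPath-fibrewise

    lift-ρ : ⟨s,t⟩ ∘ lift ≡ ρ ⟨s,t⟩
    lift-ρ = pb-unique _ _ (starts pr₁ (pb-β₁ _ _ _) liftedPath-s)
                           (starts pr₂ (pb-β₂ _ _ _) liftedPath-t)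
      where
        starts : ∀ (pr : Hom (PB x x) X) {c : Hom (M₀ X) X} → pr ∘ ⟨s,t⟩ ≡ c ∘ jₓ →
                 c ∘ liftedPath ≡ s X ∘ (M₁ pr ∘ dQ) → pr ∘ (⟨s,t⟩ ∘ lift) ≡ pr ∘ ρ ⟨s,t⟩
        starts pr {c} pr-st c-lifted = begin
          pr ∘ (⟨s,t⟩ ∘ lift)       ≡⟨ pullˡ pr-st ⟩
          (c ∘ jₓ) ∘ lift           ≡⟨ pullʳ j-lift ⟩
          c ∘ liftedPath            ≡⟨ c-lifted ⟩
          s X ∘ (M₁ pr ∘ dQ)        ≡⟨ pullˡ (sym (s-natural pr)) ⟩
          (pr ∘ s (PB x x)) ∘ dQ    ≡⟨ assoc ⟩
          pr ∘ ρ ⟨s,t⟩              ∎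

    -- On a point λ(φ) = (φ, r (s φ, t φ)) all of ψ₁, ψ₂, γ are identity
    -- paths, so κ₁, κ₂ are identities, φ' = φ, and the lift is φ again.
    λQ : Hom (MΓ x) (P ⟨s,t⟩)
    λQ = λ[ ⟨s,t⟩ ]

    ψ-λ : ∀ (pr : Hom (PB x x) X) → (M₁ pr ∘ dQ) ∘ λQ ≡ r X ∘ (pr ∘ ⟨s,t⟩)
    ψ-λ pr = trans (pullʳ (pb-β₂ _ _ _)) (trans (pullˡ (r-natural pr)) assoc)

    τκ₁-λ : (τ X ∘ κ₁) ∘ λQ ≡ r X ∘ (s X ∘ jₓ)
    τκ₁-λ = begin
      (τ X ∘ (connecting ∘ ψ₁)) ∘ λQ   ≡⟨ pullʳ (pullʳ (ψ-λ pr₁)) ⟩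
      τ X ∘ (connecting ∘ (r X ∘ (pr₁ ∘ ⟨s,t⟩))) ≡⟨ cong (τ X ∘_) (pullˡ connecting-r) ⟩
      τ X ∘ (r X ∘ (pr₁ ∘ ⟨s,t⟩))      ≡⟨ pullˡ (τ-r X) ⟩
      r X ∘ (pr₁ ∘ ⟨s,t⟩)              ≡⟨ cong (r X ∘_) (pb-β₁ _ _ _) ⟩
      r X ∘ (s X ∘ jₓ)                 ∎

    κ₂-λ : κ₂ ∘ λQ ≡ r X ∘ (t X ∘ jₓ)
    κ₂-λ = trans (pullʳ (ψ-λ pr₂)) (trans (pullˡ connecting-r) (cong (r X ∘_) (pb-β₂ _ _ _)))

    γ-λ : γ ∘ λQ ≡ r Γ ∘ (x ∘ sₓ x)
    γ-λ = trans (pullʳ (ψ-λ pr₁)) (trans (pullˡ (r-natural x))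
            (trans assoc (cong (λ z → r Γ ∘ (x ∘ z)) (pb-β₁ _ _ _))))

    φ-fib-λ : M₁ x ∘ (φ ∘ λQ) ≡ α₁ Γ ∘ ⟨ u ∘ λQ , t Γ ∘ (γ ∘ λQ) ⟩
    φ-fib-λ = trans (pullˡ φ-fib) (pullʳ (trans (⟨⟩-∘ _ _ _) (cong ⟨ u ∘ λQ ,_⟩ assoc)))

    φ'-λ : φ' ∘ λQ ≡ jₓ
    φ'-λ = begin
      φ' ∘ λQ                  ≡⟨ transported-∘ φ u γ φ-fib λQ φ-fib-λ ⟩
      transported (φ ∘ λQ) (u ∘ λQ) (γ ∘ λQ) φ-fib-λ
                               ≡⟨ transported-r (φ ∘ λQ) (u ∘ λQ) (γ ∘ λQ) φ-fib-λ (x ∘ sₓ x) γ-λ ⟩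
      (jₓ ∘ eQ) ∘ λQ           ≡⟨ pullʳ (pb-β₁ _ _ _) ⟩
      jₓ ∘ id                  ≡⟨ identityʳ ⟩
      jₓ                       ∎

    φ'κ₁⁻¹-λ : φ'κ₁⁻¹ ∘ λQ ≡ jₓ
    φ'κ₁⁻¹-λ = begin
      φ'κ₁⁻¹ ∘ λQ              ≡⟨ compose-∘ _ _ s-φ' λQ ⟩
      compose (φ' ∘ λQ) ((τ X ∘ κ₁) ∘ λQ) (composable-∘ s-φ' λQ)
                               ≡⟨ compose-cong _ (unitʳ-composable jₓ) φ'-λ τκ₁-λ ⟩
      compose jₓ (r X ∘ (s X ∘ jₓ)) (unitʳ-composable jₓ)
                               ≡⟨ compose-unitʳ jₓ ⟩
      jₓ                       ∎

    liftedPath-λ : liftedPath ∘ λQ ≡ jₓ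
    liftedPath-λ = begin
      liftedPath ∘ λQ          ≡⟨ compose-∘ _ _ s-κ₂ λQ ⟩
      compose (κ₂ ∘ λQ) (φ'κ₁⁻¹ ∘ λQ) (composable-∘ s-κ₂ λQ)
                               ≡⟨ compose-cong _ (unitˡ-composable jₓ) κ₂-λ φ'κ₁⁻¹-λ ⟩
      compose (r X ∘ (t X ∘ jₓ)) jₓ (unitˡ-composable jₓ)
                               ≡⟨ compose-unitˡ jₓ ⟩
      jₓ                       ∎

    lift-λ : lift ∘ λQ ≡ id
    lift-λ = j-mono _ _ (trans (pullˡ j-lift) (trans liftedPath-λ (sym identityʳ)))

    sₓtₓ-RStr : RStr ⟨s,t⟩
    sₓtₓ-RStr = record { p = lift ; p-λ = lift-λ ; f-p = lift-ρ }

proposition6p7 : ∀ {o ℓ} (E : PathObjectCategory o ℓ) →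
    let open POC E in
    ∀ {X Γ : Obj} (x : Hom X Γ) → RStr x →
      (⟨sₓ,tₓ⟩ x ∘ rₓ x ≡ δ x) ∧ LStr (rₓ x) ∧ RStr (⟨sₓ,tₓ⟩ x)
proposition6p7 E x rx =
    FibrewisePaths.diagonal-factorisation x
  , ContractionStructure.rₓ-LStr x
  , LiftingStructure.sₓtₓ-RStr x rx
  where open PathObjectTheory E
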